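{- There exists a finite set $F\subset\mathbb{Q}\setminus\{0\}$ such that for every $L\in\mathrm{Gr}_{n,k}(\mathbb{Q})$, $$\det(q_{L^\perp},\mathbb{Z}^{n-k})\in\{a\det(q_L,\mathbb{Z}^k):a\in F\}.$$
   Context: $1\le k<n$. $Q(x)=B_Q(x,x)$, $B_Q(x,y)=x^TM_Qy$, $M_Q$ symmetric positive definite with integer entries; $\perp$ w.r.t. $B_Q$. For a quadratic form $q$ on $\mathbb{Q}^m$, $\det(q,\mathbb{Z}^m)=\det(B_q(e_i,e_j))$; $q$ is integral if this Gram matrix is integral. $g_L=(v_1|\cdots|v_n)$ with $v_1,\dots,v_k$ a $\mathbb{Z}$-basis of $L\cap\mathbb{Z}^n$ extended to a $\mathbb{Z}$-basis of $\mathbb{Z}^n$; $q_L(u)=Q(g_L\binom{u}{0})$ ($u\in\mathbb{Q}^k$), $q_{L^\perp}(u)=c_LQ(M_Q^{*}g_L^{*}\binom{0}{u})$ ($u\in\mathbb{Q}^{n-k}$), $X^*$ inverse transpose, $c_L$ the smallest positive integer making $q_{L^\perp}$ integral. -}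

module Defs where

open import Data.Nat using (ℕ; zero; suc)
import Data.Nat as ℕ
open import Data.Integer using (ℤ)
open import Data.Fin using (Fin; zero; suc; punchIn; toℕ; _↑ˡ_; _↑ʳ_)
open import Data.Rational using (ℚ; 0ℚ; 1ℚ; _+_; _*_; -_; _<_; 1/_; ≢-nonZero; _/_)
open import Data.Rational.Properties using (_≟_)
open import Relation.Nullary using (yes; no; ¬_)
open import Relation.Binary.PropositionalEquality using (_≡_)
open import Data.Product using (Σ; ∃; _×_)
open import Data.Sum using (_⊎_)

Mat : ℕ → ℕ → Set
Mat m n = Fin m → Fin n → ℚ

ZMat : ℕ → ℕ → Set
ZMat m n = Fin m → Fin n → ℤ

Vecℚ : ℕ → Set
Vecℚ n = Fin n → ℚ

toℚMat : ∀ {m n} → ZMat m n → Mat m n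
toℚMat A i j = Data.Rational._/_ (A i j) 1

Σ[_] : ∀ n → (Fin n → ℚ) → ℚ
Σ[ zero ] f = 0ℚ
Σ[ suc n ] f = f zero + Σ[ n ] (λ i → f (suc i))

transpose : ∀ {m n} → Mat m n → Mat n m
transpose A i j = A j i

_⊗_ : ∀ {m n p} → Mat m n → Mat n p → Mat m p
_⊗_ {n = n} A B i j = Σ[ n ] (λ l → A i l * B l j)

sgn : ℕ → ℚ
sgn zero = 1ℚ
sgn (suc k) = - sgn k

minor : ∀ {n} → Mat (suc n) (suc n) → Fin (suc n) → Fin (suc n) → Mat n n
minor A r c a b = A (punchIn r a) (punchIn c b)

det : ∀ n → Mat n n → ℚ
det zero A = 1ℚ
det (suc n) A = Σ[ suc n ] (λ j → sgn (toℕ j) * (A zero j * det n (minor A zero j)))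

-- total reciprocal (0 ↦ 0); only ever applied to nonzero determinants
recip : ℚ → ℚ
recip q with q ≟ 0ℚ
... | yes _ = 0ℚ
... | no q≢0 = 1/_ q {{≢-nonZero q≢0}}

-- inverse via the adjugate: X⁻¹ = adj(X) / det X
inv : ∀ n → Mat n n → Mat n n
inv zero A ()
inv (suc n) A i j =
  recip (det (suc n) A) * (sgn (toℕ i ℕ.+ toℕ j) * det n (minor A j i))

-- inverse transpose X*
invT : ∀ n → Mat n n → Mat n n
invT n A = transpose (inv n A)

bil : ∀ {n} → Mat n n → Vecℚ n → Vecℚ n → ℚ
bil {n} M x y = Σ[ n ] (λ i → Σ[ n ] (λ j → x i * (M i j * y j)))

SymmetricZ : ∀ {n} → ZMat n n → Set
SymmetricZ {n} M = ∀ (i j : Fin n) → M i j ≡ M j i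

PositiveDefinite : ∀ {n} → Mat n n → Set
PositiveDefinite {n} M = ∀ (x : Vecℚ n) → ¬ (∀ i → x i ≡ 0ℚ) → 0ℚ < bil M x x

-- unimodular integer matrix: its columns form a ℤ-basis of ℤⁿ
Unimodular : ∀ {n} → ZMat n n → Set
Unimodular {n} g = det n (toℚMat g) ≡ 1ℚ ⊎ det n (toℚMat g) ≡ - 1ℚ

e : ∀ {n} → Fin n → Vecℚ n
e {n} i j with Data.Fin._≟_ i j
... | yes _ = 1ℚ
... | no _ = 0ℚ

_·_ : ∀ {m n} → Mat m n → Vecℚ n → Vecℚ m
_·_ {n = n} A x i = Σ[ n ] (λ j → A i j * x j)

-- Setup: n = k + m, M_Q the Gram matrix of Q, g = g_L.
module _ (k m : ℕ) (MQ : ZMat (k ℕ.+ m) (k ℕ.+ m)) (g : ZMat (k ℕ.+ m) (k ℕ.+ m)) where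

  private
    n = k ℕ.+ m
    Mq = toℚMat MQ
    gq = toℚMat g
    incL : Vecℚ k → Vecℚ n
    incL u j = Data.Sum.[ u , (λ _ → 0ℚ) ]′ (Data.Fin.splitAt k j)
    incR : Vecℚ m → Vecℚ n
    incR u j = Data.Sum.[ (λ _ → 0ℚ) , u ]′ (Data.Fin.splitAt k j)

  BQ : Vecℚ n → Vecℚ n → ℚ
  BQ = bil Mq

  -- q_L(u) = Q(g_L (u;0)); its Gram matrix w.r.t. the standard basis of ℤᵏ
  gramL : Mat k k
  gramL i j = BQ (gq · incL (e i)) (gq · incL (e j))

  -- Q(M_Q* g_L* (0;u)) before scaling by c_L; Gram matrix of that form
  gramPerp₀ : Mat m m
  gramPerp₀ i j =
    BQ (invT n Mq · (invT n gq · incR (e i))) (invT n Mq · (invT n gq · incR (e j)))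

scale : ∀ {m} → ℕ → Mat m m → Mat m m
scale c A i j = (Data.Rational._/_ (Data.Integer.+_ c) 1) * A i j

IsIntegral : ∀ {m} → Mat m m → Set
IsIntegral {m} A = ∀ (i j : Fin m) → ∃ λ (z : ℤ) → A i j ≡ Data.Rational._/_ z 1

IsSmallestIntegralScale : ∀ {m} → ℕ → Mat m m → Set
IsSmallestIntegralScale c A =
  (1 ℕ.≤ c) × IsIntegral (scale c A) × (∀ c′ → 1 ℕ.≤ c′ → IsIntegral (scale c′ A) → c ℕ.≤ c′)

-- Let g be the basis matrix g_L, G = gᵀ M_Q g the Gram matrix of Q in that basis and H = G⁻¹.
-- Then q_L has Gram matrix the upper left k × k block of G, while Q(M_Q⁻ᵀ g⁻ᵀ (0; u)) has Gram
-- matrix the lower right m × m block of H = g⁻¹ M_Q⁻ᵀ g⁻ᵀ. Jacobi's complementary minor formula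
-- det G · det H₂₂ = det G₁₁, together with det G = det gᵀ · det M_Q · det g = ±det M_Q for
-- unimodular g, gives det(q_{L⊥}) = c_L^m · (±1 / det M_Q) · det(q_L). By the adjugate formula
-- |det M_Q| · H is integral, so c_L ≤ |det M_Q| and F = {±c^m / det M_Q : 1 ≤ c ≤ |det M_Q|}.
-- Positive definiteness is only used to know det M_Q ≠ 0.

module Submission where

open import Defs
open import Data.Nat using (ℕ; _≤_)
open import Data.Rational using (ℚ; 0ℚ; _*_)
open import Data.List using (List)
open import Data.List.Relation.Unary.All using (All)
open import Data.List.Membership.Propositional using (_∈_)
open import Data.Product using (Σ; ∃; _×_)
open import Relation.Binary.PropositionalEquality using (_≡_; _≢_)

open import Algebra.Bundles using (CommutativeRing)
open import Data.Empty using (⊥-elim)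
open import Data.Fin as Fin using (Fin; zero; suc; punchIn; punchOut; toℕ; _↑ˡ_; _↑ʳ_; splitAt)
import Data.Fin.Properties as FinP
open import Data.Integer as ℤ using (ℤ; 0ℤ; 1ℤ; -1ℤ)
import Data.Integer.Properties as ℤP
open import Data.List using (map; upTo; _++_)
import Data.List.Membership.Propositional.Properties as ∈P
import Data.List.Relation.Unary.All as All
import Data.List.Relation.Unary.All.Properties as AllP
import Data.Nat as ℕ
open import Data.Nat using (zero; suc; z≤n; s≤s)
import Data.Nat.Properties as ℕP
open import Data.Product using (_,_; proj₁; proj₂)
import Data.Rational
open import Data.Rational using (1ℚ; ½; _+_; -_; _<_; positive; toℚᵘ)
import Data.Rational.Properties as ℚP
open import Algebra.Properties.Group ℚP.+-0-group using (inverseˡ-unique)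
open import Data.Rational.Solver using (module +-*-Solver)
import Data.Rational.Unnormalised as ℚᵘ
import Data.Rational.Unnormalised.Properties as ℚᵘP
open import Data.Sum using (_⊎_; inj₁; inj₂)
open import Data.Vec.Functional using (_∷_; removeAt; insertAt; updateAt)
import Data.Vec.Functional.Properties as VecP
open import Function using (_∘_)
open import Relation.Binary.Bundles using (Setoid)
open import Relation.Binary.PropositionalEquality
  using (refl; sym; trans; cong; cong₂; cong-app; subst; module ≡-Reasoning)
import Relation.Binary.Reasoning.Setoid as SetoidReasoning
open import Relation.Nullary using (yes; no; Dec)

open import Algebra.Definitions.RawSemiring Data.Rational.+-*-rawSemiring using (_^_)
open import Algebra.Properties.Semiring.Sum (CommutativeRing.semiring ℚP.+-*-commutativeRing)
  using (sum; ∑-distrib-+; ∑-comm; sum-remove; *-distribˡ-sum; *-distribʳ-sum)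

open +-*-Solver
open ≡-Reasoning

Σ≡sum : ∀ n (f : Fin n → ℚ) → Σ[ n ] f ≡ sum f
Σ≡sum zero f = refl
Σ≡sum (suc n) f = cong (f zero +_) (Σ≡sum n (λ i → f (suc i)))

Σ-cong : ∀ n {f g : Fin n → ℚ} → (∀ i → f i ≡ g i) → Σ[ n ] f ≡ Σ[ n ] g
Σ-cong zero f≗g = refl
Σ-cong (suc n) f≗g = cong₂ _+_ (f≗g zero) (Σ-cong n (λ i → f≗g (suc i)))

Σ-zero : ∀ n {f : Fin n → ℚ} → (∀ i → f i ≡ 0ℚ) → Σ[ n ] f ≡ 0ℚ
Σ-zero zero f≗0 = refl
Σ-zero (suc n) f≗0 = cong₂ _+_ (f≗0 zero) (Σ-zero n (λ i → f≗0 (suc i)))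

Σ-distrib-+ : ∀ n (f g : Fin n → ℚ) → Σ[ n ] (λ i → f i + g i) ≡ Σ[ n ] f + Σ[ n ] g
Σ-distrib-+ n f g rewrite Σ≡sum n (λ i → f i + g i) | Σ≡sum n f | Σ≡sum n g = ∑-distrib-+ f g

*-distribˡ-Σ : ∀ n c (f : Fin n → ℚ) → c * Σ[ n ] f ≡ Σ[ n ] (λ i → c * f i)
*-distribˡ-Σ n c f rewrite Σ≡sum n f | Σ≡sum n (λ i → c * f i) = *-distribˡ-sum c f

*-distribʳ-Σ : ∀ n c (f : Fin n → ℚ) → Σ[ n ] f * c ≡ Σ[ n ] (λ i → f i * c)
*-distribʳ-Σ n c f rewrite Σ≡sum n f | Σ≡sum n (λ i → f i * c) = *-distribʳ-sum c f

neg-distrib-Σ : ∀ n (f : Fin n → ℚ) → - Σ[ n ] f ≡ Σ[ n ] (λ i → - f i)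
neg-distrib-Σ zero f = refl
neg-distrib-Σ (suc n) f =
  trans (ℚP.neg-distrib-+ (f zero) _) (cong (- f zero +_) (neg-distrib-Σ n (λ i → f (suc i))))

Σ-comm : ∀ n m (f : Mat n m) →
  Σ[ n ] (λ i → Σ[ m ] (f i)) ≡ Σ[ m ] (λ j → Σ[ n ] (λ i → f i j))
Σ-comm n m f = begin
  Σ[ n ] (λ i → Σ[ m ] (f i))            ≡⟨ Σ-cong n (λ i → Σ≡sum m (f i)) ⟩
  Σ[ n ] (λ i → sum (f i))               ≡⟨ Σ≡sum n _ ⟩
  sum (λ i → sum (f i))                  ≡⟨ ∑-comm f ⟩
  sum (λ j → sum (λ i → f i j))          ≡⟨ Σ≡sum m _ ⟨
  Σ[ m ] (λ j → sum (λ i → f i j))       ≡⟨ Σ-cong m (λ j → Σ≡sum n (λ i → f i j)) ⟨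
  Σ[ m ] (λ j → Σ[ n ] (λ i → f i j))    ∎

Σ-remove : ∀ n (i : Fin (suc n)) (f : Fin (suc n) → ℚ) →
  Σ[ suc n ] f ≡ f i + Σ[ n ] (f ∘ punchIn i)
Σ-remove n i f rewrite Σ≡sum (suc n) f | Σ≡sum n (f ∘ punchIn i) = sum-remove f

Σ-single : ∀ n (i : Fin n) (f : Fin n → ℚ) → (∀ j → j ≢ i → f j ≡ 0ℚ) → Σ[ n ] f ≡ f i
Σ-single (suc n) i f others≡0 = begin
  Σ[ suc n ] f                     ≡⟨ Σ-remove n i f ⟩
  f i + Σ[ n ] (f ∘ punchIn i)     ≡⟨ cong (f i +_) (Σ-zero n (λ l → others≡0 _ (FinP.punchInᵢ≢i i l))) ⟩
  f i + 0ℚ                         ≡⟨ ℚP.+-identityʳ (f i) ⟩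
  f i                              ∎

Σ-↑ : ∀ k m (f : Fin (k ℕ.+ m) → ℚ) →
  Σ[ k ℕ.+ m ] f ≡ Σ[ k ] (λ i → f (i ↑ˡ m)) + Σ[ m ] (λ j → f (k ↑ʳ j))
Σ-↑ zero m f = sym (ℚP.+-identityˡ _)
Σ-↑ (suc k) m f =
  trans (cong (f zero +_) (Σ-↑ k m (f ∘ suc))) (sym (ℚP.+-assoc (f zero) _ _))

e-diag : ∀ {n} (i : Fin n) → e i i ≡ 1ℚ
e-diag i with i Fin.≟ i
... | yes _ = refl
... | no i≢i = ⊥-elim (i≢i refl)

e-offDiag : ∀ {n} {i j : Fin n} → i ≢ j → e i j ≡ 0ℚ
e-offDiag {i = i} {j} i≢j with i Fin.≟ j
... | yes i≡j = ⊥-elim (i≢j i≡j)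
... | no _ = refl

e-comm : ∀ {n} (i j : Fin n) → e i j ≡ e j i
e-comm i j = by-cases (i Fin.≟ j)
  where
  by-cases : Dec (i ≡ j) → e i j ≡ e j i
  by-cases (yes refl) = refl
  by-cases (no i≢j) = trans (e-offDiag i≢j) (sym (e-offDiag (i≢j ∘ sym)))

e-reindex : ∀ {m n} (ρ : Fin m → Fin n) → (∀ {i j} → ρ i ≡ ρ j → i ≡ j) →
  ∀ i j → e (ρ i) (ρ j) ≡ e i j
e-reindex ρ ρ-inj i j = by-cases (i Fin.≟ j)
  where
  by-cases : Dec (i ≡ j) → e (ρ i) (ρ j) ≡ e i j
  by-cases (yes refl) = trans (e-diag (ρ i)) (sym (e-diag i))
  by-cases (no i≢j) = trans (e-offDiag (i≢j ∘ ρ-inj)) (sym (e-offDiag i≢j))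

↑ˡ≢↑ʳ : ∀ {k m} (i : Fin k) (b : Fin m) → i ↑ˡ m ≢ k ↑ʳ b
↑ˡ≢↑ʳ {k} {m} i b eq
  with trans (sym (FinP.splitAt-↑ˡ k i m)) (trans (cong (splitAt k) eq) (FinP.splitAt-↑ʳ k m b))
... | ()

Σ-*-e : ∀ n (i : Fin n) (f : Fin n → ℚ) → Σ[ n ] (λ j → f j * e j i) ≡ f i
Σ-*-e n i f = begin
  Σ[ n ] (λ j → f j * e j i)
    ≡⟨ Σ-single n i _ (λ j j≢i → trans (cong (f j *_) (e-offDiag j≢i)) (ℚP.*-zeroʳ (f j))) ⟩
  f i * e i i                 ≡⟨ cong (f i *_) (e-diag i) ⟩
  f i * 1ℚ                    ≡⟨ ℚP.*-identityʳ (f i) ⟩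
  f i                         ∎

Σ-e-* : ∀ n (i : Fin n) (f : Fin n → ℚ) → Σ[ n ] (λ j → e i j * f j) ≡ f i
Σ-e-* n i f = trans (Σ-cong n (λ j → trans (ℚP.*-comm (e i j) (f j)) (cong (f j *_) (e-comm i j)))) (Σ-*-e n i f)

idMat : ∀ n → Mat n n
idMat n = e

infix 4 _≈ᴹ_
_≈ᴹ_ : ∀ {m n} → (A B : Mat m n) → Set
A ≈ᴹ B = ∀ i j → A i j ≡ B i j

Mat-setoid : ℕ → ℕ → Setoid _ _
Mat-setoid m n = record
  { Carrier = Mat m n
  ; _≈_ = _≈ᴹ_
  ; isEquivalence = record
    { refl = λ i j → refl
    ; sym = λ A≈B i j → sym (A≈B i j)
    ; trans = λ A≈B B≈C i j → trans (A≈B i j) (B≈C i j)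
    }
  }

module ≈ᴹ-Reasoning (m n : ℕ) = SetoidReasoning (Mat-setoid m n)
  renaming (begin_ to beginᴹ_; _∎ to _∎ᴹ)

⊗-cong : ∀ {m n p} {A A′ : Mat m n} {B B′ : Mat n p} →
  A ≈ᴹ A′ → B ≈ᴹ B′ → (A ⊗ B) ≈ᴹ (A′ ⊗ B′)
⊗-cong {n = n} A≈A′ B≈B′ i j = Σ-cong n (λ l → cong₂ _*_ (A≈A′ i l) (B≈B′ l j))

⊗-congˡ : ∀ {m n p} (A : Mat m n) {B B′ : Mat n p} →
  B ≈ᴹ B′ → (A ⊗ B) ≈ᴹ (A ⊗ B′)
⊗-congˡ A = ⊗-cong {A = A} (λ _ _ → refl)

⊗-congʳ : ∀ {m n p} {A A′ : Mat m n} {B : Mat n p} →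
  A ≈ᴹ A′ → (A ⊗ B) ≈ᴹ (A′ ⊗ B)
⊗-congʳ A≈A′ = ⊗-cong A≈A′ (λ _ _ → refl)

⊗-assoc : ∀ {m n p q} (A : Mat m n) (B : Mat n p) (C : Mat p q) →
  ((A ⊗ B) ⊗ C) ≈ᴹ (A ⊗ (B ⊗ C))
⊗-assoc {n = n} {p = p} A B C i j = begin
  Σ[ p ] (λ l → Σ[ n ] (λ t → A i t * B t l) * C l j)
    ≡⟨ Σ-cong p (λ l → *-distribʳ-Σ n (C l j) (λ t → A i t * B t l)) ⟩
  Σ[ p ] (λ l → Σ[ n ] (λ t → A i t * B t l * C l j))
    ≡⟨ Σ-comm p n (λ l t → A i t * B t l * C l j) ⟩
  Σ[ n ] (λ t → Σ[ p ] (λ l → A i t * B t l * C l j))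
    ≡⟨ Σ-cong n (λ t → Σ-cong p (λ l → ℚP.*-assoc (A i t) (B t l) (C l j))) ⟩
  Σ[ n ] (λ t → Σ[ p ] (λ l → A i t * (B t l * C l j)))
    ≡⟨ Σ-cong n (λ t → *-distribˡ-Σ p (A i t) (λ l → B t l * C l j)) ⟨
  Σ[ n ] (λ t → A i t * Σ[ p ] (λ l → B t l * C l j)) ∎

⊗-identityˡ : ∀ {p} n (A : Mat n p) → (idMat n ⊗ A) ≈ᴹ A
⊗-identityˡ n A i c = Σ-e-* n i (λ l → A l c)

⊗-identityʳ : ∀ {m} n (A : Mat m n) → (A ⊗ idMat n) ≈ᴹ A
⊗-identityʳ n A i j = Σ-*-e n j (A i)

transpose-⊗ : ∀ {m n p} (A : Mat m n) (B : Mat n p) →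
  transpose (A ⊗ B) ≈ᴹ (transpose B ⊗ transpose A)
transpose-⊗ {n = n} A B i j = Σ-cong n (λ l → ℚP.*-comm (A j l) (B l i))

-- Determinants: multilinearity in the rows

detTerm : ∀ n (A : Mat (suc n) (suc n)) → Fin (suc n) → ℚ
detTerm n A j = sgn (toℕ j) * (A zero j * det n (minor A zero j))

det-cong : ∀ n {A B : Mat n n} → A ≈ᴹ B → det n A ≡ det n B
det-cong zero A≈B = refl
det-cong (suc n) A≈B = Σ-cong (suc n) λ j →
  cong₂ (λ x y → sgn (toℕ j) * (x * y)) (A≈B zero j) (det-cong n (λ a b → A≈B (suc a) (punchIn j b)))

term≡0ˡ : ∀ s a d → a ≡ 0ℚ → s * (a * d) ≡ 0ℚ
term≡0ˡ s a d refl = trans (cong (s *_) (ℚP.*-zeroˡ d)) (ℚP.*-zeroʳ s)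

term≡0ʳ : ∀ s a d → d ≡ 0ℚ → s * (a * d) ≡ 0ℚ
term≡0ʳ s a d refl = trans (cong (s *_) (ℚP.*-zeroʳ a)) (ℚP.*-zeroʳ s)

det-row-+ : ∀ n (A B C : Mat n n) (r : Fin n) →
  (∀ c → A r c ≡ B r c + C r c) →
  (∀ i → i ≢ r → ∀ c → A i c ≡ B i c) → (∀ i → i ≢ r → ∀ c → A i c ≡ C i c) →
  det n A ≡ det n B + det n C
det-row-+ (suc n) A B C r Aʳ≡ A≡B A≡C =
  trans (Σ-cong (suc n) (term r Aʳ≡ A≡B A≡C)) (Σ-distrib-+ (suc n) (detTerm n B) (detTerm n C))
  where
  term : ∀ r → (∀ c → A r c ≡ B r c + C r c) → (∀ i → i ≢ r → ∀ c → A i c ≡ B i c) →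
    (∀ i → i ≢ r → ∀ c → A i c ≡ C i c) → ∀ j → detTerm n A j ≡ detTerm n B j + detTerm n C j
  term zero A₀≡ A≡B A≡C j = begin
    sgn (toℕ j) * (A zero j * det n (minor A zero j))
      ≡⟨ cong₂ (λ x y → sgn (toℕ j) * (x * y)) (A₀≡ j) (det-cong n (λ a b → A≡B (suc a) (λ ()) _)) ⟩
    sgn (toℕ j) * ((B zero j + C zero j) * det n (minor B zero j))
      ≡⟨ solve 4 (λ s b c d → s :* ((b :+ c) :* d) := s :* (b :* d) :+ s :* (c :* d)) refl
           (sgn (toℕ j)) (B zero j) (C zero j) (det n (minor B zero j)) ⟩
    detTerm n B j + sgn (toℕ j) * (C zero j * det n (minor B zero j))
      ≡⟨ cong (λ d → detTerm n B j + sgn (toℕ j) * (C zero j * d))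
           (det-cong n (λ a b → trans (sym (A≡B (suc a) (λ ()) _)) (A≡C (suc a) (λ ()) _))) ⟩
    detTerm n B j + detTerm n C j ∎
  term (suc r) Aʳ≡ A≡B A≡C j = begin
    sgn (toℕ j) * (A zero j * det n (minor A zero j))
      ≡⟨ cong (λ d → sgn (toℕ j) * (A zero j * d)) minor≡ ⟩
    sgn (toℕ j) * (A zero j * (det n (minor B zero j) + det n (minor C zero j)))
      ≡⟨ solve 4 (λ s a x y → s :* (a :* (x :+ y)) := s :* (a :* x) :+ s :* (a :* y)) refl
           (sgn (toℕ j)) (A zero j) (det n (minor B zero j)) (det n (minor C zero j)) ⟩
    sgn (toℕ j) * (A zero j * det n (minor B zero j)) + sgn (toℕ j) * (A zero j * det n (minor C zero j))
      ≡⟨ cong₂ (λ x y → sgn (toℕ j) * (x * det n (minor B zero j)) + sgn (toℕ j) * (y * det n (minor C zero j)))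
           (A≡B zero (λ ()) j) (A≡C zero (λ ()) j) ⟩
    detTerm n B j + detTerm n C j ∎
    where
    minor≡ : det n (minor A zero j) ≡ det n (minor B zero j) + det n (minor C zero j)
    minor≡ = det-row-+ n (minor A zero j) (minor B zero j) (minor C zero j) r (λ c → Aʳ≡ _)
      (λ i i≢r c → A≡B (suc i) (i≢r ∘ FinP.suc-injective) _)
      (λ i i≢r c → A≡C (suc i) (i≢r ∘ FinP.suc-injective) _)

det-row-* : ∀ n (A B : Mat n n) (r : Fin n) (λ′ : ℚ) →
  (∀ c → A r c ≡ λ′ * B r c) → (∀ i → i ≢ r → ∀ c → A i c ≡ B i c) →
  det n A ≡ λ′ * det n B
det-row-* (suc n) A B r λ′ Aʳ≡ A≡B =
  trans (Σ-cong (suc n) (term r Aʳ≡ A≡B)) (sym (*-distribˡ-Σ (suc n) λ′ (detTerm n B)))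
  where
  pull : ∀ s a l d → s * ((l * a) * d) ≡ l * (s * (a * d))
  pull = solve 4 (λ s a l d → s :* ((l :* a) :* d) := l :* (s :* (a :* d))) refl
  term : ∀ r → (∀ c → A r c ≡ λ′ * B r c) → (∀ i → i ≢ r → ∀ c → A i c ≡ B i c) →
    ∀ j → detTerm n A j ≡ λ′ * detTerm n B j
  term zero A₀≡ A≡B j =
    trans (cong₂ (λ x y → sgn (toℕ j) * (x * y)) (A₀≡ j) (det-cong n (λ a b → A≡B (suc a) (λ ()) _)))
          (pull (sgn (toℕ j)) (B zero j) λ′ _)
  term (suc r) Aʳ≡ A≡B j =
    trans (cong₂ (λ x y → sgn (toℕ j) * (x * y)) (A≡B zero (λ ()) j) minor≡)
          (trans (cong (sgn (toℕ j) *_) (sym (ℚP.*-assoc (B zero j) λ′ _)))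
          (trans (cong (λ x → sgn (toℕ j) * (x * det n (minor B zero j))) (ℚP.*-comm (B zero j) λ′))
                 (pull (sgn (toℕ j)) (B zero j) λ′ _)))
    where
    minor≡ : det n (minor A zero j) ≡ λ′ * det n (minor B zero j)
    minor≡ = det-row-* n (minor A zero j) (minor B zero j) r λ′ (λ c → Aʳ≡ _)
      (λ i i≢r c → A≡B (suc i) (i≢r ∘ FinP.suc-injective) _)

det-zeroColumn : ∀ n (A : Mat n n) (c : Fin n) → (∀ i → A i c ≡ 0ℚ) → det n A ≡ 0ℚ
det-zeroColumn (suc n) A c col≡0 = Σ-zero (suc n) term
  where
  term : ∀ j → detTerm n A j ≡ 0ℚ
  term j with j Fin.≟ c
  ... | yes refl = term≡0ˡ (sgn (toℕ j)) (A zero j) (det n (minor A zero j)) (col≡0 zero)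
  ... | no j≢c = term≡0ʳ (sgn (toℕ j)) (A zero j) (det n (minor A zero j))
                   (det-zeroColumn n (minor A zero j) (punchOut j≢c)
                   (λ i → trans (cong (A (suc i)) (FinP.punchIn-punchOut j≢c)) (col≡0 (suc i))))

det-idMat : ∀ n → det n (idMat n) ≡ 1ℚ
det-idMat zero = refl
det-idMat (suc n) = begin
  det (suc n) (idMat (suc n))
    ≡⟨ Σ-single (suc n) zero (detTerm n (idMat (suc n)))
         (λ j j≢0 → term≡0ˡ (sgn (toℕ j)) (e zero j) _ (e-offDiag (j≢0 ∘ sym))) ⟩
  1ℚ * (e {suc n} zero zero * det n (minor (idMat (suc n)) zero zero))
    ≡⟨ cong₂ (λ x y → 1ℚ * (x * y)) (e-diag {suc n} zero)
         (trans (det-cong n (e-reindex suc FinP.suc-injective)) (det-idMat n)) ⟩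
  1ℚ ∎

-- Determinants: alternation

sgn-involutive : ∀ k → sgn k * sgn k ≡ 1ℚ
sgn-involutive zero = refl
sgn-involutive (suc k) =
  trans (solve 1 (λ s → (:- s) :* (:- s) := s :* s) refl (sgn k)) (sgn-involutive k)

sgn-+ : ∀ a b → sgn (a ℕ.+ b) ≡ sgn a * sgn b
sgn-+ zero b = sym (ℚP.*-identityˡ (sgn b))
sgn-+ (suc a) b = trans (cong -_ (sgn-+ a b)) (ℚP.neg-distribˡ-* (sgn a) (sgn b))

sgn*x≡y⇒x≡sgn*y : ∀ k x y → sgn k * x ≡ y → x ≡ sgn k * y
sgn*x≡y⇒x≡sgn*y k x y eq = begin
  x                       ≡⟨ ℚP.*-identityˡ x ⟨
  1ℚ * x                  ≡⟨ cong (_* x) (sgn-involutive k) ⟨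
  (sgn k * sgn k) * x     ≡⟨ ℚP.*-assoc (sgn k) (sgn k) x ⟩
  sgn k * (sgn k * x)     ≡⟨ cong (sgn k *_) eq ⟩
  sgn k * y               ∎

sgn*x≡0⇒x≡0 : ∀ k x → sgn k * x ≡ 0ℚ → x ≡ 0ℚ
sgn*x≡0⇒x≡0 k x eq = trans (sgn*x≡y⇒x≡sgn*y k x 0ℚ eq) (ℚP.*-zeroʳ (sgn k))

x≡-x⇒x≡0 : ∀ x → x ≡ - x → x ≡ 0ℚ
x≡-x⇒x≡0 x x≡-x = begin
  x                 ≡⟨ solve 1 (λ x → x := con ½ :* (x :+ x)) refl x ⟩
  ½ * (x + x)       ≡⟨ cong (λ y → ½ * (x + y)) x≡-x ⟩
  ½ * (x + - x)     ≡⟨ cong (½ *_) (ℚP.+-inverseʳ x) ⟩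
  ½ * 0ℚ            ≡⟨ ℚP.*-zeroʳ ½ ⟩
  0ℚ                ∎

-- Deleting columns j and c of a matrix, in either order, leaves the same columns.
punchIn-punchOut-comm : ∀ {n} (j c : Fin (suc (suc n))) (j≢c : j ≢ c) (c≢j : c ≢ j) (b : Fin n) →
  punchIn j (punchIn (punchOut j≢c) b) ≡ punchIn c (punchIn (punchOut c≢j) b)
punchIn-punchOut-comm zero zero j≢c c≢j b = ⊥-elim (j≢c refl)
punchIn-punchOut-comm zero (suc c) j≢c c≢j b = refl
punchIn-punchOut-comm (suc j) zero j≢c c≢j b = refl
punchIn-punchOut-comm {zero} (suc zero) (suc zero) j≢c c≢j b = ⊥-elim (j≢c refl)
punchIn-punchOut-comm {suc n} (suc j) (suc c) j≢c c≢j zero = refl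
punchIn-punchOut-comm {suc n} (suc j) (suc c) j≢c c≢j (suc b) =
  cong suc (punchIn-punchOut-comm j c (j≢c ∘ cong suc) (c≢j ∘ cong suc) b)

pairSign : ∀ {n} (j c : Fin (suc (suc n))) → j ≢ c → ℚ
pairSign j c j≢c = sgn (toℕ j) * sgn (toℕ (punchOut j≢c))

pairSign-antisym : ∀ {n} (j c : Fin (suc (suc n))) (j≢c : j ≢ c) (c≢j : c ≢ j) →
  pairSign j c j≢c ≡ - pairSign c j c≢j
pairSign-antisym zero zero j≢c c≢j = ⊥-elim (j≢c refl)
pairSign-antisym zero (suc c) j≢c c≢j =
  solve 1 (λ s → con 1ℚ :* s := :- ((:- s) :* con 1ℚ)) refl (sgn (toℕ c))
pairSign-antisym (suc j) zero j≢c c≢j =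
  solve 1 (λ s → (:- s) :* con 1ℚ := :- (con 1ℚ :* s)) refl (sgn (toℕ j))
pairSign-antisym {zero} (suc zero) (suc zero) j≢c c≢j = ⊥-elim (j≢c refl)
pairSign-antisym {suc n} (suc j) (suc c) j≢c c≢j = begin
  (- sgn (toℕ j)) * (- sgn (toℕ (punchOut (j≢c ∘ cong suc))))
    ≡⟨ neg*neg (sgn (toℕ j)) _ ⟩
  pairSign j c (j≢c ∘ cong suc)
    ≡⟨ pairSign-antisym j c (j≢c ∘ cong suc) (c≢j ∘ cong suc) ⟩
  - pairSign c j (c≢j ∘ cong suc)
    ≡⟨ cong -_ (neg*neg (sgn (toℕ c)) _) ⟨
  - ((- sgn (toℕ c)) * (- sgn (toℕ (punchOut (c≢j ∘ cong suc))))) ∎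
  where
  neg*neg : ∀ a b → (- a) * (- b) ≡ a * b
  neg*neg = solve 2 (λ a b → (:- a) :* (:- b) := a :* b) refl

minor₀₁ : ∀ {n} (A : Mat (suc (suc n)) (suc (suc n))) (j c : Fin (suc (suc n))) → j ≢ c → Mat n n
minor₀₁ A j c j≢c a b = A (suc (suc a)) (punchIn j (punchIn (punchOut j≢c) b))

-- The summand of the expansion of det A along its first two rows that uses columns j and c.
pairTerm : ∀ {n} (A : Mat (suc (suc n)) (suc (suc n))) (j c : Fin (suc (suc n))) → ℚ
pairTerm {n} A j c with j Fin.≟ c
... | yes _ = 0ℚ
... | no j≢c = pairSign j c j≢c * (A zero j * (A (suc zero) c * det n (minor₀₁ A j c j≢c)))

pairTerm-diag : ∀ {n} (A : Mat (suc (suc n)) (suc (suc n))) j → pairTerm A j j ≡ 0ℚ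
pairTerm-diag A j with j Fin.≟ j
... | yes _ = refl
... | no j≢j = ⊥-elim (j≢j refl)

pairTerm-offDiag : ∀ {n} (A : Mat (suc (suc n)) (suc (suc n))) j c (j≢c : j ≢ c) →
  pairTerm A j c ≡ pairSign j c j≢c * (A zero j * (A (suc zero) c * det n (minor₀₁ A j c j≢c)))
pairTerm-offDiag {n} A j c j≢c with j Fin.≟ c
... | yes j≡c = ⊥-elim (j≢c j≡c)
... | no j≢c′ = cong₂ (λ x y → x * (A zero j * (A (suc zero) c * y)))
    (cong (λ i → sgn (toℕ j) * sgn (toℕ i)) punchOut≡)
    (det-cong n (λ a b → cong (λ i → A (suc (suc a)) (punchIn j (punchIn i b))) punchOut≡))
  where
  punchOut≡ : punchOut j≢c′ ≡ punchOut j≢c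
  punchOut≡ = FinP.punchOut-cong j refl

det-pairExpansion : ∀ n (A : Mat (suc (suc n)) (suc (suc n))) →
  det (suc (suc n)) A ≡ Σ[ suc (suc n) ] (λ j → Σ[ suc (suc n) ] (pairTerm A j))
det-pairExpansion n A = Σ-cong (suc (suc n)) row
  where
  row : ∀ j → detTerm (suc n) A j ≡ Σ[ suc (suc n) ] (pairTerm A j)
  row j = begin
    sgn (toℕ j) * (A zero j * Σ[ suc n ] (detTerm n (minor A zero j)))
      ≡⟨ cong (sgn (toℕ j) *_) (*-distribˡ-Σ (suc n) (A zero j) (detTerm n (minor A zero j))) ⟩
    sgn (toℕ j) * Σ[ suc n ] (λ l → A zero j * detTerm n (minor A zero j) l)
      ≡⟨ *-distribˡ-Σ (suc n) (sgn (toℕ j)) (λ l → A zero j * detTerm n (minor A zero j) l) ⟩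
    Σ[ suc n ] (λ l → sgn (toℕ j) * (A zero j * detTerm n (minor A zero j) l))
      ≡⟨ Σ-cong (suc n) term ⟨
    Σ[ suc n ] (pairTerm A j ∘ punchIn j)
      ≡⟨ ℚP.+-identityˡ _ ⟨
    0ℚ + Σ[ suc n ] (pairTerm A j ∘ punchIn j)
      ≡⟨ cong (_+ Σ[ suc n ] (pairTerm A j ∘ punchIn j)) (pairTerm-diag A j) ⟨
    pairTerm A j j + Σ[ suc n ] (pairTerm A j ∘ punchIn j)
      ≡⟨ Σ-remove (suc n) j (pairTerm A j) ⟨
    Σ[ suc (suc n) ] (pairTerm A j) ∎
    where
    term : ∀ l → pairTerm A j (punchIn j l) ≡ sgn (toℕ j) * (A zero j * detTerm n (minor A zero j) l)
    term l = begin
      pairTerm A j (punchIn j l)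
        ≡⟨ pairTerm-offDiag A j (punchIn j l) j≢ ⟩
      pairSign j (punchIn j l) j≢ * (A zero j * (A (suc zero) (punchIn j l) * det n (minor₀₁ A j (punchIn j l) j≢)))
        ≡⟨ cong₂ (λ i y → (sgn (toℕ j) * sgn (toℕ i)) * (A zero j * (A (suc zero) (punchIn j l) * y)))
             punchOut≡
             (det-cong n (λ a b → cong (λ i → A (suc (suc a)) (punchIn j (punchIn i b))) punchOut≡)) ⟩
      (sgn (toℕ j) * sgn (toℕ l)) * (A zero j * (A (suc zero) (punchIn j l) * det n (minor (minor A zero j) zero l)))
        ≡⟨ solve 5 (λ s a t b d → (s :* t) :* (a :* (b :* d)) := s :* (a :* (t :* (b :* d)))) refl
             (sgn (toℕ j)) (A zero j) (sgn (toℕ l)) (A (suc zero) (punchIn j l))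
             (det n (minor (minor A zero j) zero l)) ⟩
      sgn (toℕ j) * (A zero j * detTerm n (minor A zero j) l) ∎
      where
      j≢ : j ≢ punchIn j l
      j≢ = FinP.punchInᵢ≢i j l ∘ sym
      punchOut≡ : punchOut j≢ ≡ l
      punchOut≡ = trans (FinP.punchOut-cong j refl) (FinP.punchOut-punchIn j)

-- In the pair expansion, swapping the first two rows exchanges the roles of j and c and flips the sign.
det-swap₀₁ : ∀ n (A B : Mat (suc (suc n)) (suc (suc n))) →
  (∀ c → B zero c ≡ A (suc zero) c) → (∀ c → B (suc zero) c ≡ A zero c) →
  (∀ a c → B (suc (suc a)) c ≡ A (suc (suc a)) c) →
  det (suc (suc n)) B ≡ - det (suc (suc n)) A
det-swap₀₁ n A B B₀≡ B₁≡ B₂≡ = begin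
  det N B
    ≡⟨ det-pairExpansion n B ⟩
  Σ[ N ] (λ j → Σ[ N ] (pairTerm B j))
    ≡⟨ Σ-cong N (λ j → Σ-cong N (swapped j)) ⟩
  Σ[ N ] (λ j → Σ[ N ] (λ c → - pairTerm A c j))
    ≡⟨ Σ-cong N (λ j → neg-distrib-Σ N (λ c → pairTerm A c j)) ⟨
  Σ[ N ] (λ j → - Σ[ N ] (λ c → pairTerm A c j))
    ≡⟨ neg-distrib-Σ N (λ j → Σ[ N ] (λ c → pairTerm A c j)) ⟨
  - Σ[ N ] (λ j → Σ[ N ] (λ c → pairTerm A c j))
    ≡⟨ cong -_ (Σ-comm N N (λ j c → pairTerm A c j)) ⟩
  - Σ[ N ] (λ c → Σ[ N ] (pairTerm A c))
    ≡⟨ cong -_ (det-pairExpansion n A) ⟨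
  - det N A ∎
  where
  N = suc (suc n)
  swapped : ∀ j c → pairTerm B j c ≡ - pairTerm A c j
  swapped j c = by-cases (j Fin.≟ c)
    where
    by-cases : Dec (j ≡ c) → pairTerm B j c ≡ - pairTerm A c j
    by-cases (yes refl) = trans (pairTerm-diag B j) (sym (cong -_ (pairTerm-diag A j)))
    by-cases (no j≢c) = begin
      pairTerm B j c
        ≡⟨ pairTerm-offDiag B j c j≢c ⟩
      pairSign j c j≢c * (B zero j * (B (suc zero) c * det n (minor₀₁ B j c j≢c)))
        ≡⟨ cong₂ (λ x y → pairSign j c j≢c * (x * y))
             (B₀≡ j) (cong₂ _*_ (B₁≡ c) (det-cong n (λ a b → B₂≡ a _))) ⟩
      pairSign j c j≢c * (A (suc zero) j * (A zero c * det n (minor₀₁ A j c j≢c)))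
        ≡⟨ cong₂ (λ x y → x * (A (suc zero) j * (A zero c * y))) (pairSign-antisym j c j≢c c≢j)
             (det-cong n (λ a b → cong (A (suc (suc a))) (punchIn-punchOut-comm j c j≢c c≢j b))) ⟩
      (- pairSign c j c≢j) * (A (suc zero) j * (A zero c * det n (minor₀₁ A c j c≢j)))
        ≡⟨ solve 4 (λ s a b d → (:- s) :* (b :* (a :* d)) := :- (s :* (a :* (b :* d)))) refl
             (pairSign c j c≢j) (A zero c) (A (suc zero) j) (det n (minor₀₁ A c j c≢j)) ⟩
      - (pairSign c j c≢j * (A zero c * (A (suc zero) j * det n (minor₀₁ A c j c≢j))))
        ≡⟨ cong -_ (pairTerm-offDiag A c j c≢j) ⟨
      - pairTerm A c j ∎
      where
      c≢j : c ≢ j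
      c≢j = j≢c ∘ sym

moveToTop : ∀ {r N} → Fin (suc r) → Mat (suc r) N → Mat (suc r) N
moveToTop j A = A j ∷ removeAt A j

det-moveToTop : ∀ n (j : Fin (suc n)) (A : Mat (suc n) (suc n)) →
  det (suc n) (moveToTop j A) ≡ sgn (toℕ j) * det (suc n) A
det-moveToTop n zero A =
  trans (det-cong (suc n) {moveToTop zero A} {A} (λ { zero c → refl ; (suc i) c → refl }))
    (sym (ℚP.*-identityˡ (det (suc n) A)))
det-moveToTop (suc n) (suc j) A = begin
  det N (moveToTop (suc j) A)
    ≡⟨ det-swap₀₁ n C (moveToTop (suc j) A) (λ c → refl) (λ c → refl) (λ a c → refl) ⟩
  - det N C
    ≡⟨ cong -_ (Σ-cong N minorsMoved) ⟩
  - Σ[ N ] (λ l → sgn (toℕ j) * detTerm (suc n) A l)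
    ≡⟨ cong -_ (*-distribˡ-Σ N (sgn (toℕ j)) (detTerm (suc n) A)) ⟨
  - (sgn (toℕ j) * det N A)
    ≡⟨ ℚP.neg-distribˡ-* (sgn (toℕ j)) (det N A) ⟩
  sgn (toℕ (suc j)) * det N A ∎
  where
  N = suc (suc n)
  C : Mat N N
  C = A zero ∷ moveToTop j (A ∘ suc)
  minorsMoved : ∀ l → detTerm (suc n) C l ≡ sgn (toℕ j) * detTerm (suc n) A l
  minorsMoved l = begin
    sgn (toℕ l) * (A zero l * det (suc n) (minor C zero l))
      ≡⟨ cong (λ d → sgn (toℕ l) * (A zero l * d))
           (trans (det-cong (suc n) {minor C zero l} {moveToTop j (minor A zero l)}
                    (λ { zero b → refl ; (suc a) b → refl }))
             (det-moveToTop n j (minor A zero l))) ⟩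
    sgn (toℕ l) * (A zero l * (sgn (toℕ j) * det (suc n) (minor A zero l)))
      ≡⟨ solve 4 (λ s a t d → s :* (a :* (t :* d)) := t :* (s :* (a :* d))) refl
           (sgn (toℕ l)) (A zero l) (sgn (toℕ j)) (det (suc n) (minor A zero l)) ⟩
    sgn (toℕ j) * detTerm (suc n) A l ∎

det-equalRows₀ : ∀ n (A : Mat (suc n) (suc n)) (j : Fin n) →
  (∀ c → A zero c ≡ A (suc j) c) → det (suc n) A ≡ 0ℚ
det-equalRows₀ (suc n) A j A₀≡Aⱼ =
  sgn*x≡0⇒x≡0 (toℕ (suc j)) (det (suc (suc n)) A) (trans (sym (det-moveToTop (suc n) (suc j) A))
    (x≡-x⇒x≡0 (det (suc (suc n)) A′)
      (det-swap₀₁ n A′ A′ rows₀₁≡ (sym ∘ rows₀₁≡) (λ a c → refl))))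
  where
  A′ = moveToTop (suc j) A
  rows₀₁≡ : ∀ c → A′ zero c ≡ A′ (suc zero) c
  rows₀₁≡ c = sym (A₀≡Aⱼ c)

det-equalRows : ∀ n (A : Mat n n) (i j : Fin n) → i ≢ j → (∀ c → A i c ≡ A j c) → det n A ≡ 0ℚ
det-equalRows (suc n) A zero zero i≢j Aᵢ≡Aⱼ = ⊥-elim (i≢j refl)
det-equalRows (suc n) A zero (suc j) i≢j Aᵢ≡Aⱼ = det-equalRows₀ n A j Aᵢ≡Aⱼ
det-equalRows (suc n) A (suc i) zero i≢j Aᵢ≡Aⱼ = det-equalRows₀ n A i (sym ∘ Aᵢ≡Aⱼ)
det-equalRows (suc n) A (suc i) (suc j) i≢j Aᵢ≡Aⱼ = Σ-zero (suc n) λ l →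
  term≡0ʳ (sgn (toℕ l)) (A zero l) (det n (minor A zero l))
    (det-equalRows n (minor A zero l) i j (i≢j ∘ cong suc) (λ c → Aᵢ≡Aⱼ _))

det-expandRow : ∀ n (A : Mat (suc n) (suc n)) (j : Fin (suc n)) →
  det (suc n) A ≡ sgn (toℕ j) * Σ[ suc n ] (λ l → sgn (toℕ l) * (A j l * det n (minor A j l)))
det-expandRow n A j = sgn*x≡y⇒x≡sgn*y (toℕ j) _ _ (sym (det-moveToTop n j A))

-- This computes det of A with row j replaced by row i, which has two equal rows.
det-alienCofactors : ∀ n (A : Mat (suc n) (suc n)) (i j : Fin (suc n)) → i ≢ j →
  Σ[ suc n ] (λ l → sgn (toℕ l) * (A i l * det n (minor A j l))) ≡ 0ℚ
det-alienCofactors n A i j i≢j =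
  sgn*x≡0⇒x≡0 (toℕ j) (Σ[ suc n ] (λ l → sgn (toℕ l) * (A i l * det n (minor A j l)))) (begin
  sgn (toℕ j) * Σ[ suc n ] (λ l → sgn (toℕ l) * (A i l * det n (minor A j l)))
    ≡⟨ cong (sgn (toℕ j) *_) (Σ-cong (suc n) (λ l → cong₂ (λ x y → sgn (toℕ l) * (x * y))
         (sym (replaced l)) (det-cong n (λ a b → sym (kept (punchIn j a) (FinP.punchInᵢ≢i j a) (punchIn l b)))))) ⟩
  sgn (toℕ j) * Σ[ suc n ] (λ l → sgn (toℕ l) * (A′ j l * det n (minor A′ j l)))
    ≡⟨ det-expandRow n A′ j ⟨
  det (suc n) A′
    ≡⟨ det-equalRows (suc n) A′ i j i≢j (λ c → trans (kept i i≢j c) (sym (replaced c))) ⟩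
  0ℚ ∎)
  where
  A′ = updateAt A j (λ _ → A i)
  replaced : ∀ c → A′ j c ≡ A i c
  replaced = cong-app (VecP.updateAt-updates j A)
  kept : ∀ r → r ≢ j → ∀ c → A′ r c ≡ A r c
  kept r r≢j = cong-app (VecP.updateAt-minimal r j A r≢j)

-- The adjugate formula for the inverse

recip-inverseˡ : ∀ d → d ≢ 0ℚ → recip d * d ≡ 1ℚ
recip-inverseˡ d d≢0 with d ℚP.≟ 0ℚ
... | yes d≡0 = ⊥-elim (d≢0 d≡0)
... | no d≢0′ = ℚP.*-inverseˡ d {{Data.Rational.≢-nonZero d≢0′}}

inv-inverseʳ : ∀ n (A : Mat n n) → det n A ≢ 0ℚ → (A ⊗ inv n A) ≈ᴹ idMat n
inv-inverseʳ (suc n) A detA≢0 i j = begin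
  Σ[ suc n ] (λ l → A i l * (r * (sgn (toℕ l ℕ.+ toℕ j) * det n (minor A j l))))
    ≡⟨ Σ-cong (suc n) (λ l → trans
         (cong (λ z → A i l * (r * (z * det n (minor A j l)))) (sgn-+ (toℕ l) (toℕ j)))
         (solve 5 (λ a r s t d → a :* (r :* ((s :* t) :* d)) := (r :* t) :* (s :* (a :* d))) refl
           (A i l) r (sgn (toℕ l)) (sgn (toℕ j)) (det n (minor A j l)))) ⟩
    Σ[ suc n ] (λ l → (r * sgn (toℕ j)) * (sgn (toℕ l) * (A i l * det n (minor A j l))))
    ≡⟨ *-distribˡ-Σ (suc n) (r * sgn (toℕ j)) (λ l → sgn (toℕ l) * (A i l * det n (minor A j l))) ⟨
  (r * sgn (toℕ j)) * S
    ≡⟨ by-cases (i Fin.≟ j) ⟩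
  e i j ∎
  where
  r = recip (det (suc n) A)
  S = Σ[ suc n ] (λ l → sgn (toℕ l) * (A i l * det n (minor A j l)))
  by-cases : Dec (i ≡ j) → (r * sgn (toℕ j)) * S ≡ e i j
  by-cases (yes refl) = begin
    (r * sgn (toℕ j)) * S
      ≡⟨ cong ((r * sgn (toℕ j)) *_) (sgn*x≡y⇒x≡sgn*y (toℕ j) S _ (sym (det-expandRow n A j))) ⟩
    (r * sgn (toℕ j)) * (sgn (toℕ j) * det (suc n) A)
      ≡⟨ solve 3 (λ r t d → (r :* t) :* (t :* d) := r :* d :* (t :* t)) refl r (sgn (toℕ j)) (det (suc n) A) ⟩
    r * det (suc n) A * (sgn (toℕ j) * sgn (toℕ j))
      ≡⟨ cong₂ _*_ (recip-inverseˡ _ detA≢0) (sgn-involutive (toℕ j)) ⟩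
    1ℚ
      ≡⟨ e-diag j ⟨
    e j j ∎
  by-cases (no i≢j) = begin
    (r * sgn (toℕ j)) * S   ≡⟨ cong ((r * sgn (toℕ j)) *_) (det-alienCofactors n A i j i≢j) ⟩
    (r * sgn (toℕ j)) * 0ℚ  ≡⟨ ℚP.*-zeroʳ (r * sgn (toℕ j)) ⟩
    0ℚ                      ≡⟨ e-offDiag i≢j ⟨
    e i j                   ∎

-- Alternating multilinear functions of the rows, and the product formula

record IsAlternatingMultilinear {r N} (f : Mat r N → ℚ) : Set where
  field
    f-cong : ∀ {A B} → A ≈ᴹ B → f A ≡ f B
    f-row-+ : ∀ (A B C : Mat r N) (i : Fin r) → (∀ c → A i c ≡ B i c + C i c) →
      (∀ k → k ≢ i → ∀ c → A k c ≡ B k c) → (∀ k → k ≢ i → ∀ c → A k c ≡ C k c) →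
      f A ≡ f B + f C
    f-row-* : ∀ (A B : Mat r N) (i : Fin r) (λ′ : ℚ) → (∀ c → A i c ≡ λ′ * B i c) →
      (∀ k → k ≢ i → ∀ c → A k c ≡ B k c) → f A ≡ λ′ * f B
    f-equalRows : ∀ (A : Mat r N) (i j : Fin r) → i ≢ j → (∀ c → A i c ≡ A j c) → f A ≡ 0ℚ

open IsAlternatingMultilinear

punchInCases : ∀ {n} (i : Fin (suc n)) (P : Fin (suc n) → Set) → P i → (∀ k → P (punchIn i k)) → ∀ k → P k
punchInCases i P Pᵢ P-punchIn k with i Fin.≟ k
... | yes refl = Pᵢ
... | no i≢k = subst P (FinP.punchIn-punchOut i≢k) (P-punchIn (punchOut i≢k))

insertRow-isAlternatingMultilinear : ∀ {r N} {f : Mat (suc r) N → ℚ} → IsAlternatingMultilinear f →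
  (i : Fin (suc r)) (v : Fin N → ℚ) → IsAlternatingMultilinear (λ X → f (insertAt X i v))
insertRow-isAlternatingMultilinear {r} {N} {f} f-alt i v = record
  { f-cong = λ X≈Y → f-cong f-alt (insertAt-≈ X≈Y)
  ; f-row-+ = λ X Y Z k Xₖ≡ X≡Y X≡Z → f-row-+ f-alt _ _ _ (punchIn i k)
      (λ c → trans (row X k c) (trans (Xₖ≡ c) (sym (cong₂ _+_ (row Y k c) (row Z k c)))))
      (others X Y k X≡Y) (others X Z k X≡Z)
  ; f-row-* = λ X Y k λ′ Xₖ≡ X≡Y → f-row-* f-alt _ _ (punchIn i k) λ′
      (λ c → trans (row X k c) (trans (Xₖ≡ c) (sym (cong (λ′ *_) (row Y k c)))))
      (others X Y k X≡Y)
  ; f-equalRows = λ X k k′ k≢k′ Xₖ≡Xₖ′ → f-equalRows f-alt _ (punchIn i k) (punchIn i k′)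
      (k≢k′ ∘ FinP.punchIn-injective i k k′)
      (λ c → trans (row X k c) (trans (Xₖ≡Xₖ′ c) (sym (row X k′ c))))
  }
  where
  row : ∀ X k c → insertAt X i v (punchIn i k) c ≡ X k c
  row X k c = cong-app (VecP.insertAt-punchIn X i v k) c
  inserted : ∀ X Y c → insertAt X i v i c ≡ insertAt Y i v i c
  inserted X Y c = trans (cong-app (VecP.insertAt-lookup X i v) c) (sym (cong-app (VecP.insertAt-lookup Y i v) c))
  insertAt-≈ : ∀ {X Y : Mat r N} → X ≈ᴹ Y → insertAt X i v ≈ᴹ insertAt Y i v
  insertAt-≈ {X} {Y} X≈Y = punchInCases i (λ k → ∀ c → insertAt X i v k c ≡ insertAt Y i v k c)
    (inserted X Y) (λ k c → trans (row X k c) (trans (X≈Y k c) (sym (row Y k c))))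
  others : ∀ (X Y : Mat r N) k → (∀ k′ → k′ ≢ k → ∀ c → X k′ c ≡ Y k′ c) →
    ∀ k′ → k′ ≢ punchIn i k → ∀ c → insertAt X i v k′ c ≡ insertAt Y i v k′ c
  others X Y k X≡Y = punchInCases i
    (λ k′ → k′ ≢ punchIn i k → ∀ c → insertAt X i v k′ c ≡ insertAt Y i v k′ c)
    (λ _ → inserted X Y)
    (λ k′ k′≢k c → trans (row X k′ c) (trans (X≡Y k′ (k′≢k ∘ cong (punchIn i)) c) (sym (row Y k′ c))))

insertAt-0-pointwise : ∀ {N} (j : Fin (suc N)) (_∙_ : ℚ → ℚ → ℚ) → 0ℚ ∙ 0ℚ ≡ 0ℚ →
  (x y z : Fin N → ℚ) →
  (∀ c → x c ≡ y c ∙ z c) → ∀ c → insertAt x j 0ℚ c ≡ insertAt y j 0ℚ c ∙ insertAt z j 0ℚ c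
insertAt-0-pointwise j _∙_ 0∙0≡0 x y z x≡ = punchInCases j
  (λ c → insertAt x j 0ℚ c ≡ insertAt y j 0ℚ c ∙ insertAt z j 0ℚ c)
  (trans (VecP.insertAt-lookup x j 0ℚ)
    (trans (sym 0∙0≡0) (sym (cong₂ _∙_ (VecP.insertAt-lookup y j 0ℚ) (VecP.insertAt-lookup z j 0ℚ)))))
  (λ c → trans (VecP.insertAt-punchIn x j 0ℚ c)
    (trans (x≡ c) (sym (cong₂ _∙_ (VecP.insertAt-punchIn y j 0ℚ c) (VecP.insertAt-punchIn z j 0ℚ c)))))

insertColumn-isAlternatingMultilinear : ∀ {r N} {f : Mat r (suc N) → ℚ} → IsAlternatingMultilinear f →
  (j : Fin (suc N)) → IsAlternatingMultilinear (λ X → f (λ a → insertAt (X a) j 0ℚ))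
insertColumn-isAlternatingMultilinear {r} {N} {f} f-alt j = record
  { f-cong = λ {X} {Y} X≈Y → f-cong f-alt (λ a → insertAt-≗ (X a) (Y a) (X≈Y a))
  ; f-row-+ = λ X Y Z i Xᵢ≡ X≡Y X≡Z → f-row-+ f-alt _ _ _ i
      (insertAt-0-pointwise j _+_ (ℚP.+-identityʳ 0ℚ) (X i) (Y i) (Z i) Xᵢ≡)
      (λ k k≢i → insertAt-≗ (X k) (Y k) (X≡Y k k≢i)) (λ k k≢i → insertAt-≗ (X k) (Z k) (X≡Z k k≢i))
  ; f-row-* = λ X Y i λ′ Xᵢ≡ X≡Y → f-row-* f-alt _ _ i λ′
      (insertAt-0-pointwise j (λ a _ → λ′ * a) (ℚP.*-zeroʳ λ′) (X i) (Y i) (Y i) Xᵢ≡)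
      (λ k k≢i → insertAt-≗ (X k) (Y k) (X≡Y k k≢i))
  ; f-equalRows = λ X i i′ i≢i′ Xᵢ≡Xᵢ′ →
      f-equalRows f-alt _ i i′ i≢i′ (insertAt-≗ (X i) (X i′) Xᵢ≡Xᵢ′)
  }
  where
  insertAt-≗ : ∀ (x y : Fin N → ℚ) → (∀ c → x c ≡ y c) →
    ∀ c → insertAt x j 0ℚ c ≡ insertAt y j 0ℚ c
  insertAt-≗ x y x≗y = insertAt-0-pointwise j (λ a _ → a) refl x y y x≗y

swapRows₀₁ : ∀ {r N} {f : Mat (suc (suc r)) N → ℚ} → IsAlternatingMultilinear f →
  (A B : Mat (suc (suc r)) N) →
  (∀ c → B zero c ≡ A (suc zero) c) → (∀ c → B (suc zero) c ≡ A zero c) →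
  (∀ a c → B (suc (suc a)) c ≡ A (suc (suc a)) c) → f B ≡ - f A
swapRows₀₁ {r} {N} {f} f-alt A B B₀≡ B₁≡ B₂≡ = inverseˡ-unique (f B) (f A) sum≡0
  where
  a₀ = A zero
  a₁ = A (suc zero)
  s : Fin N → ℚ
  s c = a₀ c + a₁ c
  R : (Fin N → ℚ) → (Fin N → ℚ) → Mat (suc (suc r)) N
  R u v = u ∷ v ∷ (λ k → A (suc (suc k)))
  R-equal : ∀ u → f (R u u) ≡ 0ℚ
  R-equal u = f-equalRows f-alt (R u u) zero (suc zero) (λ ()) (λ c → refl)
  others₀ : ∀ u u′ v k → k ≢ zero → ∀ c → R u v k c ≡ R u′ v k c
  others₀ u u′ v zero k≢0 c = ⊥-elim (k≢0 refl)
  others₀ u u′ v (suc k) k≢0 c = refl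
  others₁ : ∀ u v v′ k → k ≢ suc zero → ∀ c → R u v k c ≡ R u v′ k c
  others₁ u v v′ zero k≢1 c = refl
  others₁ u v v′ (suc zero) k≢1 c = ⊥-elim (k≢1 refl)
  others₁ u v v′ (suc (suc k)) k≢1 c = refl
  split₁ : ∀ u → f (R u s) ≡ f (R u a₀) + f (R u a₁)
  split₁ u = f-row-+ f-alt _ _ _ (suc zero) (λ c → refl) (others₁ u s a₀) (others₁ u s a₁)
  sum≡0 : f B + f A ≡ 0ℚ
  sum≡0 = begin
    f B + f A
      ≡⟨ cong₂ _+_
           (f-cong f-alt λ { zero c → B₀≡ c ; (suc zero) c → B₁≡ c ; (suc (suc k)) c → B₂≡ k c })
           (f-cong f-alt λ { zero c → refl ; (suc zero) c → refl ; (suc (suc k)) c → refl }) ⟩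
    f (R a₁ a₀) + f (R a₀ a₁)
      ≡⟨ solve 2 (λ x y → y :+ x := (con 0ℚ :+ x) :+ (y :+ con 0ℚ)) refl (f (R a₀ a₁)) (f (R a₁ a₀)) ⟩
    (0ℚ + f (R a₀ a₁)) + (f (R a₁ a₀) + 0ℚ)
      ≡⟨ cong₂ (λ x y → (x + f (R a₀ a₁)) + (f (R a₁ a₀) + y)) (R-equal a₀) (R-equal a₁) ⟨
    (f (R a₀ a₀) + f (R a₀ a₁)) + (f (R a₁ a₀) + f (R a₁ a₁))
      ≡⟨ cong₂ _+_ (split₁ a₀) (split₁ a₁) ⟨
    f (R a₀ s) + f (R a₁ s)
      ≡⟨ f-row-+ f-alt _ _ _ zero (λ c → refl) (others₀ s a₀ s) (others₀ s a₁ s) ⟨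
    f (R s s)
      ≡⟨ R-equal s ⟩
    0ℚ ∎

moveToTop-sign : ∀ {r N} {f : Mat (suc r) N → ℚ} → IsAlternatingMultilinear f →
  (j : Fin (suc r)) (A : Mat (suc r) N) → f (moveToTop j A) ≡ sgn (toℕ j) * f A
moveToTop-sign f-alt zero A =
  trans (f-cong f-alt (λ { zero c → refl ; (suc i) c → refl })) (sym (ℚP.*-identityˡ _))
moveToTop-sign {suc r} {N} {f} f-alt (suc j) A = begin
  f (moveToTop (suc j) A)
    ≡⟨ swapRows₀₁ f-alt C (moveToTop (suc j) A) (λ c → refl) (λ c → refl) (λ a c → refl) ⟩
  - f C
    ≡⟨ cong -_ (f-cong f-alt λ { zero c → refl ; (suc i) c → refl }) ⟩
  - f (insertAt (moveToTop j (A ∘ suc)) zero (A zero))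
    ≡⟨ cong -_ (moveToTop-sign (insertRow-isAlternatingMultilinear f-alt zero (A zero)) j (A ∘ suc)) ⟩
  - (sgn (toℕ j) * f (insertAt (A ∘ suc) zero (A zero)))
    ≡⟨ cong (λ x → - (sgn (toℕ j) * x)) (f-cong f-alt λ { zero c → refl ; (suc i) c → refl }) ⟩
  - (sgn (toℕ j) * f A)
    ≡⟨ ℚP.neg-distribˡ-* (sgn (toℕ j)) (f A) ⟩
  sgn (toℕ (suc j)) * f A ∎
  where
  C : Mat (suc (suc r)) N
  C = A zero ∷ moveToTop j (A ∘ suc)

addMultipleOfRow₀ToRow₁ : ∀ {r N} {f : Mat (suc (suc r)) N → ℚ} → IsAlternatingMultilinear f →
  (A : Mat (suc (suc r)) N) (λ′ : ℚ) →
  f (A zero ∷ (λ c → A (suc zero) c + λ′ * A zero c) ∷ (λ k → A (suc (suc k)))) ≡ f A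
addMultipleOfRow₀ToRow₁ {r} {N} {f} f-alt A λ′ = begin
  f (withRow₁ (λ c → A (suc zero) c + λ′ * A zero c))
    ≡⟨ f-row-+ f-alt _ _ _ (suc zero) (λ c → refl) (others _ _) (others _ _) ⟩
  f (withRow₁ (A (suc zero))) + f (withRow₁ (λ c → λ′ * A zero c))
    ≡⟨ cong₂ _+_ (f-cong f-alt λ { zero c → refl ; (suc zero) c → refl ; (suc (suc k)) c → refl })
                 (f-row-* f-alt _ _ (suc zero) λ′ (λ c → refl) (others _ _)) ⟩
  f A + λ′ * f (withRow₁ (A zero))
    ≡⟨ cong (λ x → f A + λ′ * x) (f-equalRows f-alt _ zero (suc zero) (λ ()) (λ c → refl)) ⟩
  f A + λ′ * 0ℚ
    ≡⟨ solve 2 (λ x l → x :+ l :* con 0ℚ := x) refl (f A) λ′ ⟩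
  f A ∎
  where
  withRow₁ : (Fin N → ℚ) → Mat (suc (suc r)) N
  withRow₁ v = A zero ∷ v ∷ (λ k → A (suc (suc k)))
  others : ∀ v w k → k ≢ suc zero → ∀ c → withRow₁ v k c ≡ withRow₁ w k c
  others v w zero k≢1 c = refl
  others v w (suc zero) k≢1 c = ⊥-elim (k≢1 refl)
  others v w (suc (suc k)) k≢1 c = refl

addMultiplesOfRow₀ : ∀ {r N} {f : Mat (suc r) N → ℚ} → IsAlternatingMultilinear f →
  (A B : Mat (suc r) N) (λ′ : Fin r → ℚ) →
  (∀ c → B zero c ≡ A zero c) → (∀ a c → B (suc a) c ≡ A (suc a) c + λ′ a * A zero c) → f B ≡ f A
addMultiplesOfRow₀ {zero} f-alt A B λ′ B₀≡ Bₛ≡ = f-cong f-alt λ { zero c → B₀≡ c ; (suc ()) c }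
addMultiplesOfRow₀ {suc r} {N} {f} f-alt A B λ′ B₀≡ Bₛ≡ = begin
  f B
    ≡⟨ f-cong f-alt (λ { zero c → refl ; (suc zero) c → refl ; (suc (suc k)) c → refl }) ⟩
  f (insertAt (removeAt B (suc zero)) (suc zero) (B (suc zero)))
    ≡⟨ addMultiplesOfRow₀ (insertRow-isAlternatingMultilinear f-alt (suc zero) (B (suc zero)))
         (removeAt A (suc zero)) (removeAt B (suc zero)) (λ′ ∘ suc) B₀≡ (Bₛ≡ ∘ suc) ⟩
  f (insertAt (removeAt A (suc zero)) (suc zero) (B (suc zero)))
    ≡⟨ f-cong f-alt (λ { zero c → refl ; (suc zero) c → Bₛ≡ zero c ; (suc (suc k)) c → refl }) ⟩
  f (A zero ∷ (λ c → A (suc zero) c + λ′ zero * A zero c) ∷ (λ k → A (suc (suc k))))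
    ≡⟨ addMultipleOfRow₀ToRow₁ f-alt A (λ′ zero) ⟩
  f A ∎

expandRow₀ : ∀ {r N} {f : Mat (suc r) N → ℚ} → IsAlternatingMultilinear f →
  ∀ K (λ′ : Fin K → ℚ) (v : Mat K N) (A : Mat (suc r) N) →
  (∀ c → A zero c ≡ Σ[ K ] (λ t → λ′ t * v t c)) →
  f A ≡ Σ[ K ] (λ t → λ′ t * f (v t ∷ (A ∘ suc)))
expandRow₀ {f = f} f-alt zero λ′ v A A₀≡ =
  trans (f-row-* f-alt A A zero 0ℚ (λ c → trans (A₀≡ c) (sym (ℚP.*-zeroˡ (A zero c)))) (λ k _ c → refl))
        (ℚP.*-zeroˡ (f A))
expandRow₀ {r} {N} {f} f-alt (suc K) λ′ v A A₀≡ = begin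
  f A
    ≡⟨ f-row-+ f-alt A (first ∷ A′) (rest ∷ A′) zero A₀≡ (sameTail A) (sameTail A) ⟩
  f (first ∷ A′) + f (rest ∷ A′)
    ≡⟨ cong₂ _+_ (f-row-* f-alt _ (v zero ∷ A′) zero (λ′ zero) (λ c → refl) (sameTail (first ∷ A′)))
                 (expandRow₀ f-alt K (λ′ ∘ suc) (v ∘ suc) (rest ∷ A′) (λ c → refl)) ⟩
  λ′ zero * f (v zero ∷ A′) + Σ[ K ] (λ t → λ′ (suc t) * f (v (suc t) ∷ A′)) ∎
  where
  A′ = A ∘ suc
  first rest : Fin N → ℚ
  first c = λ′ zero * v zero c
  rest c = Σ[ K ] (λ t → λ′ (suc t) * v (suc t) c)
  sameTail : ∀ (B : Mat (suc r) N) {w} → ∀ k → k ≢ zero → ∀ c → B k c ≡ (w ∷ (B ∘ suc)) k c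
  sameTail B zero k≢0 c = ⊥-elim (k≢0 refl)
  sameTail B (suc k) _ c = refl

insertUnitRow : ∀ {n} → Fin (suc n) → Mat n n → Mat (suc n) (suc n)
insertUnitRow j X = insertAt (λ a → insertAt (X a) j 0ℚ) zero (e j)

insertUnitRow-isAlternatingMultilinear : ∀ {n} {f : Mat (suc n) (suc n) → ℚ} → IsAlternatingMultilinear f →
  (j : Fin (suc n)) → IsAlternatingMultilinear (λ X → f (insertUnitRow j X))
insertUnitRow-isAlternatingMultilinear f-alt j =
  insertColumn-isAlternatingMultilinear (insertRow-isAlternatingMultilinear f-alt zero (e j)) j

insertUnitRow-idMat : ∀ {n} (j : Fin (suc n)) → insertUnitRow j (idMat n) ≈ᴹ moveToTop j (idMat (suc n))
insertUnitRow-idMat j zero c = refl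
insertUnitRow-idMat j (suc a) = punchInCases j (λ c → insertAt (e a) j 0ℚ c ≡ e (punchIn j a) c)
  (trans (VecP.insertAt-lookup (e a) j 0ℚ) (sym (e-offDiag (FinP.punchInᵢ≢i j a))))
  (λ c → trans (VecP.insertAt-punchIn (e a) j 0ℚ c) (sym (e-reindex (punchIn j) (FinP.punchIn-injective j _ _) a c)))

-- Clearing column j below the unit row e j of (e j ∷ tail A) leaves the minor of A at (0, j).
insertUnitRow-minor : ∀ {n} (A : Mat (suc n) (suc n)) (j : Fin (suc n)) a c →
  insertUnitRow j (minor A zero j) (suc a) c ≡ A (suc a) c + (- A (suc a) j) * e j c
insertUnitRow-minor A j a = punchInCases j
  (λ c → insertAt (minor A zero j a) j 0ℚ c ≡ A (suc a) c + (- A (suc a) j) * e j c)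
  (begin
    insertAt (minor A zero j a) j 0ℚ j    ≡⟨ VecP.insertAt-lookup (minor A zero j a) j 0ℚ ⟩
    0ℚ
      ≡⟨ solve 1 (λ x → con 0ℚ := x :+ (:- x) :* con 1ℚ) refl (A (suc a) j) ⟩
    A (suc a) j + (- A (suc a) j) * 1ℚ   ≡⟨ cong (λ z → A (suc a) j + (- A (suc a) j) * z) (e-diag j) ⟨
    A (suc a) j + (- A (suc a) j) * e j j ∎)
  (λ c → begin
    insertAt (minor A zero j a) j 0ℚ (punchIn j c)  ≡⟨ VecP.insertAt-punchIn (minor A zero j a) j 0ℚ c ⟩
    A (suc a) (punchIn j c)
      ≡⟨ solve 2 (λ x y → x := x :+ y :* con 0ℚ) refl _ (- A (suc a) j) ⟩
    A (suc a) (punchIn j c) + (- A (suc a) j) * 0ℚ  ≡⟨ cong (λ z → A (suc a) (punchIn j c) + (- A (suc a) j) * z)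
                                                         (e-offDiag (FinP.punchInᵢ≢i j c ∘ sym)) ⟨
    A (suc a) (punchIn j c) + (- A (suc a) j) * e j (punchIn j c) ∎)

alternating-unique : ∀ n {f : Mat n n → ℚ} → IsAlternatingMultilinear f → ∀ A → f A ≡ det n A * f (idMat n)
alternating-unique zero f-alt A = trans (f-cong f-alt (λ ())) (sym (ℚP.*-identityˡ _))
alternating-unique (suc n) {f} f-alt A = begin
  f A
    ≡⟨ expandRow₀ f-alt (suc n) (A zero) e A (λ c → sym (Σ-*-e (suc n) c (A zero))) ⟩
  Σ[ suc n ] (λ j → A zero j * f (e j ∷ (A ∘ suc)))
    ≡⟨ Σ-cong (suc n) (λ j → cong (A zero j *_) (unitRow j)) ⟩
  Σ[ suc n ] (λ j → A zero j * (det n (minor A zero j) * (sgn (toℕ j) * f I)))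
    ≡⟨ Σ-cong (suc n) (λ j → solve 4 (λ a d s F → a :* (d :* (s :* F)) := (s :* (a :* d)) :* F) refl
         (A zero j) (det n (minor A zero j)) (sgn (toℕ j)) (f I)) ⟩
  Σ[ suc n ] (λ j → detTerm n A j * f I)
    ≡⟨ *-distribʳ-Σ (suc n) (f I) (detTerm n A) ⟨
  det (suc n) A * f I ∎
  where
  I = idMat (suc n)
  unitRow : ∀ j → f (e j ∷ (A ∘ suc)) ≡ det n (minor A zero j) * (sgn (toℕ j) * f I)
  unitRow j = begin
    f (e j ∷ (A ∘ suc))
      ≡⟨ addMultiplesOfRow₀ f-alt (e j ∷ (A ∘ suc)) (insertUnitRow j (minor A zero j)) (λ a → - A (suc a) j)
           (λ c → refl) (insertUnitRow-minor A j) ⟨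
    f (insertUnitRow j (minor A zero j))
      ≡⟨ alternating-unique n (insertUnitRow-isAlternatingMultilinear f-alt j) (minor A zero j) ⟩
    det n (minor A zero j) * f (insertUnitRow j (idMat n))
      ≡⟨ cong (det n (minor A zero j) *_) (trans (f-cong f-alt (insertUnitRow-idMat j)) (moveToTop-sign f-alt j I)) ⟩
    det n (minor A zero j) * (sgn (toℕ j) * f I) ∎

det-isAlternatingMultilinear : ∀ n → IsAlternatingMultilinear (det n)
det-isAlternatingMultilinear n = record
  { f-cong = det-cong n
  ; f-row-+ = det-row-+ n
  ; f-row-* = det-row-* n
  ; f-equalRows = det-equalRows n
  }

⊗-rows : ∀ {m n p} (A B : Mat m n) (M : Mat n p) i k →
  (∀ l → A i l ≡ B k l) → ∀ c → (A ⊗ M) i c ≡ (B ⊗ M) k c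
⊗-rows {n = n} A B M i k Aᵢ≡Bₖ c = Σ-cong n (λ l → cong (_* M l c) (Aᵢ≡Bₖ l))

⊗ʳ-isAlternatingMultilinear : ∀ {r n} {f : Mat r n → ℚ} → IsAlternatingMultilinear f →
  (M : Mat n n) → IsAlternatingMultilinear (λ A → f (A ⊗ M))
⊗ʳ-isAlternatingMultilinear {r} {n} {f} f-alt M = record
  { f-cong = λ A≈B → f-cong f-alt (⊗-congʳ A≈B)
  ; f-row-+ = λ A B C i Aᵢ≡ A≡B A≡C → f-row-+ f-alt _ _ _ i
      (λ c → trans (Σ-cong n (λ l → trans (cong (_* M l c) (Aᵢ≡ l)) (ℚP.*-distribʳ-+ (M l c) (B i l) (C i l))))
                   (Σ-distrib-+ n (λ l → B i l * M l c) (λ l → C i l * M l c)))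
      (λ k k≢i → ⊗-rows A B M k k (A≡B k k≢i)) (λ k k≢i → ⊗-rows A C M k k (A≡C k k≢i))
  ; f-row-* = λ A B i λ′ Aᵢ≡ A≡B → f-row-* f-alt _ _ i λ′
      (λ c → trans (Σ-cong n (λ l → trans (cong (_* M l c) (Aᵢ≡ l)) (ℚP.*-assoc λ′ (B i l) (M l c))))
                   (sym (*-distribˡ-Σ n λ′ (λ l → B i l * M l c))))
      (λ k k≢i → ⊗-rows A B M k k (A≡B k k≢i))
  ; f-equalRows = λ A i j i≢j Aᵢ≡Aⱼ → f-equalRows f-alt _ i j i≢j (⊗-rows A A M i j Aᵢ≡Aⱼ)
  }

det-⊗ : ∀ n (A M : Mat n n) → det n (A ⊗ M) ≡ det n A * det n M
det-⊗ n A M = trans (alternating-unique n (⊗ʳ-isAlternatingMultilinear (det-isAlternatingMultilinear n) M) A)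
                    (cong (det n A *_) (det-cong n (⊗-identityˡ n M)))

inverseʳ⇒det≢0 : ∀ n (A B : Mat n n) → (A ⊗ B) ≈ᴹ idMat n → det n B ≢ 0ℚ
inverseʳ⇒det≢0 n A B AB≈I detB≡0 = ℚP.1≢0 (begin
  1ℚ                  ≡⟨ det-idMat n ⟨
  det n (idMat n)     ≡⟨ det-cong n AB≈I ⟨
  det n (A ⊗ B)       ≡⟨ det-⊗ n A B ⟩
  det n A * det n B   ≡⟨ cong (det n A *_) detB≡0 ⟩
  det n A * 0ℚ        ≡⟨ ℚP.*-zeroʳ (det n A) ⟩
  0ℚ                  ∎)

inverseʳ⇒inverseˡ : ∀ n (A B : Mat n n) → (A ⊗ B) ≈ᴹ idMat n → (B ⊗ A) ≈ᴹ idMat n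
inverseʳ⇒inverseˡ n A B AB≈I = beginᴹ
  B ⊗ A                  ≈⟨ ⊗-congˡ B A≈B⁻¹ ⟩
  B ⊗ inv n B            ≈⟨ inv-inverseʳ n B detB≢0 ⟩
  idMat n                ∎ᴹ
  where
  open ≈ᴹ-Reasoning n n
  detB≢0 = inverseʳ⇒det≢0 n A B AB≈I
  A≈B⁻¹ : A ≈ᴹ inv n B
  A≈B⁻¹ = beginᴹ
    A                      ≈⟨ ⊗-identityʳ n A ⟨
    A ⊗ idMat n            ≈⟨ ⊗-congˡ A (inv-inverseʳ n B detB≢0) ⟨
    A ⊗ (B ⊗ inv n B)      ≈⟨ ⊗-assoc A B (inv n B) ⟨
    (A ⊗ B) ⊗ inv n B      ≈⟨ ⊗-congʳ AB≈I ⟩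
    idMat n ⊗ inv n B      ≈⟨ ⊗-identityˡ n (inv n B) ⟩
    inv n B                ∎ᴹ

transpose-inverse : ∀ n (A B : Mat n n) → (B ⊗ A) ≈ᴹ idMat n → (transpose A ⊗ transpose B) ≈ᴹ idMat n
transpose-inverse n A B BA≈I i j = trans (sym (transpose-⊗ B A i j)) (trans (BA≈I j i) (e-comm j i))

-- Block matrices

↑-cases : ∀ k m (r : Fin (k ℕ.+ m)) → (∃ λ i → r ≡ i ↑ˡ m) ⊎ (∃ λ b → r ≡ k ↑ʳ b)
↑-cases k m r with splitAt k r in eq
... | inj₁ i = inj₁ (i , sym (FinP.splitAt⁻¹-↑ˡ eq))
... | inj₂ b = inj₂ (b , sym (FinP.splitAt⁻¹-↑ʳ eq))

punchIn-↑ˡ-↑ʳ : ∀ k m (a : Fin (suc k)) (b : Fin m) → punchIn (a ↑ˡ m) (k ↑ʳ b) ≡ suc k ↑ʳ b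
punchIn-↑ˡ-↑ʳ k m zero b = refl
punchIn-↑ˡ-↑ʳ (suc k) m (suc a) b = cong suc (punchIn-↑ˡ-↑ʳ k m a b)

punchIn-↑ˡ-↑ˡ : ∀ k m (a : Fin (suc k)) (j : Fin k) → punchIn (a ↑ˡ m) (j ↑ˡ m) ≡ punchIn a j ↑ˡ m
punchIn-↑ˡ-↑ˡ k m zero j = refl
punchIn-↑ˡ-↑ˡ (suc k) m (suc a) zero = refl
punchIn-↑ˡ-↑ˡ (suc k) m (suc a) (suc j) = cong suc (punchIn-↑ˡ-↑ˡ k m a j)

upperLeft : ∀ k m → Mat (k ℕ.+ m) (k ℕ.+ m) → Mat k k
upperLeft k m A i j = A (i ↑ˡ m) (j ↑ˡ m)

lowerRight : ∀ k m → Mat (k ℕ.+ m) (k ℕ.+ m) → Mat m m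
lowerRight k m A a b = A (k ↑ʳ a) (k ↑ʳ b)

det-blockLowerTriangular : ∀ k m (A : Mat (k ℕ.+ m) (k ℕ.+ m)) → (∀ i b → A (i ↑ˡ m) (k ↑ʳ b) ≡ 0ℚ) →
  det (k ℕ.+ m) A ≡ det k (upperLeft k m A) * det m (lowerRight k m A)
det-blockLowerTriangular zero m A upperRight≡0 = sym (ℚP.*-identityˡ _)
det-blockLowerTriangular (suc k) m A upperRight≡0 = begin
  Σ[ suc k ℕ.+ m ] (detTerm (k ℕ.+ m) A)
    ≡⟨ Σ-↑ (suc k) m (detTerm (k ℕ.+ m) A) ⟩
  Σ[ suc k ] (λ a → detTerm (k ℕ.+ m) A (a ↑ˡ m)) + Σ[ m ] (λ b → detTerm (k ℕ.+ m) A (suc k ↑ʳ b))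
    ≡⟨ cong₂ _+_ (Σ-cong (suc k) leftTerm)
                 (Σ-zero m (λ b → term≡0ˡ (sgn (toℕ (suc k ↑ʳ b))) _
                                    (det (k ℕ.+ m) (minor A zero (suc k ↑ʳ b))) (upperRight≡0 zero b))) ⟩
  Σ[ suc k ] (λ a → detTerm k X a * det m Z) + 0ℚ
    ≡⟨ ℚP.+-identityʳ _ ⟩
  Σ[ suc k ] (λ a → detTerm k X a * det m Z)
    ≡⟨ *-distribʳ-Σ (suc k) (det m Z) (detTerm k X) ⟨
  det (suc k) X * det m Z ∎
  where
  X = upperLeft (suc k) m A
  Z = lowerRight (suc k) m A
  leftTerm : ∀ a → detTerm (k ℕ.+ m) A (a ↑ˡ m) ≡ detTerm k X a * det m Z
  leftTerm a = begin
    sgn (toℕ (a ↑ˡ m)) * (A zero (a ↑ˡ m) * det (k ℕ.+ m) (minor A zero (a ↑ˡ m)))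
      ≡⟨ cong₂ (λ s d → sgn s * (A zero (a ↑ˡ m) * d)) (FinP.toℕ-↑ˡ a m)
           (det-blockLowerTriangular k m (minor A zero (a ↑ˡ m))
             (λ i b → trans (cong (A (suc i ↑ˡ m)) (punchIn-↑ˡ-↑ʳ k m a b)) (upperRight≡0 (suc i) b))) ⟩
    sgn (toℕ a) * (X zero a * (det k (upperLeft k m (minor A zero (a ↑ˡ m)))
                               * det m (lowerRight k m (minor A zero (a ↑ˡ m)))))
      ≡⟨ cong₂ (λ d z → sgn (toℕ a) * (X zero a * (d * z)))
           (det-cong k (λ i j → cong (A (suc i ↑ˡ m)) (punchIn-↑ˡ-↑ˡ k m a j)))
           (det-cong m (λ a′ b → cong (A (suc (k ↑ʳ a′))) (punchIn-↑ˡ-↑ʳ k m a b))) ⟩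
    sgn (toℕ a) * (X zero a * (det k (minor X zero a) * det m Z))
      ≡⟨ solve 4 (λ s x d z → s :* (x :* (d :* z)) := s :* (x :* d) :* z) refl
           (sgn (toℕ a)) (X zero a) (det k (minor X zero a)) (det m Z) ⟩
    detTerm k X a * det m Z ∎

det-blockUpperUnitriangular : ∀ k m (A : Mat (k ℕ.+ m) (k ℕ.+ m)) →
  upperLeft k m A ≈ᴹ idMat k → (∀ a j → A (k ↑ʳ a) (j ↑ˡ m) ≡ 0ℚ) →
  det (k ℕ.+ m) A ≡ det m (lowerRight k m A)
det-blockUpperUnitriangular zero m A upperLeft≈I lowerLeft≡0 = refl
det-blockUpperUnitriangular (suc k) m A upperLeft≈I lowerLeft≡0 = begin
  Σ[ suc k ℕ.+ m ] (detTerm (k ℕ.+ m) A)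
    ≡⟨ Σ-↑ (suc k) m (detTerm (k ℕ.+ m) A) ⟩
  Σ[ suc k ] (λ a → detTerm (k ℕ.+ m) A (a ↑ˡ m)) + Σ[ m ] (λ b → detTerm (k ℕ.+ m) A (suc k ↑ʳ b))
    ≡⟨ cong₂ _+_
         (Σ-single (suc k) zero _ (λ a a≢0 →
           term≡0ˡ (sgn (toℕ (a ↑ˡ m))) _ (det (k ℕ.+ m) (minor A zero (a ↑ˡ m)))
           (trans (upperLeft≈I zero a) (e-offDiag (a≢0 ∘ sym)))))
         (Σ-zero m (λ b → term≡0ʳ (sgn (toℕ (suc k ↑ʳ b))) (A zero (suc k ↑ʳ b)) _
           (det-zeroColumn (k ℕ.+ m) (minor A zero (suc k ↑ʳ b)) (punchOut sk↑b≢0)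
             (λ r → trans (cong (A (suc r)) (FinP.punchIn-punchOut sk↑b≢0)) (column₀ r))))) ⟩
  1ℚ * (A zero zero * det (k ℕ.+ m) (minor A zero zero)) + 0ℚ
    ≡⟨ cong₂ (λ x y → 1ℚ * (x * y) + 0ℚ) (trans (upperLeft≈I zero zero) (e-diag {suc k} zero))
         (det-blockUpperUnitriangular k m (minor A zero zero)
           (λ i j → trans (upperLeft≈I (suc i) (suc j)) (e-reindex suc FinP.suc-injective i j))
           (λ a j → lowerLeft≡0 a (suc j))) ⟩
  1ℚ * (1ℚ * det m (lowerRight (suc k) m A)) + 0ℚ
    ≡⟨ solve 1 (λ x → con 1ℚ :* (con 1ℚ :* x) :+ con 0ℚ := x) refl _ ⟩
  det m (lowerRight (suc k) m A) ∎
  where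
  sk↑b≢0 : ∀ {b} → suc k ↑ʳ b ≢ zero
  sk↑b≢0 ()
  column₀ : ∀ r → A (suc r) zero ≡ 0ℚ
  column₀ r with ↑-cases k m r
  ... | inj₁ (i , refl) = trans (upperLeft≈I (suc i) zero) (e-offDiag {i = suc i} {zero} (λ ()))
  ... | inj₂ (b , refl) = lowerLeft≡0 b zero

identityWithRightColumns : ∀ k m → Mat (k ℕ.+ m) (k ℕ.+ m) → Mat (k ℕ.+ m) (k ℕ.+ m)
identityWithRightColumns k m H r c = Data.Sum.[ (λ _ → e r c) , (λ _ → H r c) ]′ (splitAt k c)

-- G ⊗ identityWithRightColumns H is block lower triangular with diagonal blocks upperLeft G and I.
jacobi-complementaryMinor : ∀ k m (G H : Mat (k ℕ.+ m) (k ℕ.+ m)) → (G ⊗ H) ≈ᴹ idMat (k ℕ.+ m) →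
  det (k ℕ.+ m) G * det m (lowerRight k m H) ≡ det k (upperLeft k m G)
jacobi-complementaryMinor k m G H GH≈I = begin
  det N G * det m (lowerRight k m H)
    ≡⟨ cong (det N G *_) detQ ⟨
  det N G * det N Q
    ≡⟨ det-⊗ N G Q ⟨
  det N (G ⊗ Q)
    ≡⟨ det-blockLowerTriangular k m (G ⊗ Q)
         (λ i b → trans (GQ-right (i ↑ˡ m) b) (e-offDiag (↑ˡ≢↑ʳ i b))) ⟩
  det k (upperLeft k m (G ⊗ Q)) * det m (lowerRight k m (G ⊗ Q))
    ≡⟨ cong₂ _*_ (det-cong k (λ i j → GQ-left (i ↑ˡ m) j))
                 (trans (det-cong m (λ a b → trans (GQ-right (k ↑ʳ a) b)
                                                  (e-reindex (k ↑ʳ_) (FinP.↑ʳ-injective k _ _) a b)))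
                        (det-idMat m)) ⟩
  det k (upperLeft k m G) * 1ℚ
    ≡⟨ ℚP.*-identityʳ _ ⟩
  det k (upperLeft k m G) ∎
  where
  N = k ℕ.+ m
  Q = identityWithRightColumns k m H
  Q-left : ∀ r (j : Fin k) → Q r (j ↑ˡ m) ≡ e r (j ↑ˡ m)
  Q-left r j rewrite FinP.splitAt-↑ˡ k j m = refl
  Q-right : ∀ r (b : Fin m) → Q r (k ↑ʳ b) ≡ H r (k ↑ʳ b)
  Q-right r b rewrite FinP.splitAt-↑ʳ k m b = refl
  detQ : det N Q ≡ det m (lowerRight k m H)
  detQ = trans (det-blockUpperUnitriangular k m Q
                 (λ i j → trans (Q-left (i ↑ˡ m) j) (e-reindex (_↑ˡ m) (FinP.↑ˡ-injective m _ _) i j))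
                 (λ a j → trans (Q-left (k ↑ʳ a) j) (e-offDiag (↑ˡ≢↑ʳ j a ∘ sym))))
               (det-cong m (λ a b → Q-right (k ↑ʳ a) b))
  GQ-left : ∀ r (j : Fin k) → (G ⊗ Q) r (j ↑ˡ m) ≡ G r (j ↑ˡ m)
  GQ-left r j = trans (Σ-cong N (λ t → cong (G r t *_) (Q-left t j))) (Σ-*-e N (j ↑ˡ m) (G r))
  GQ-right : ∀ r (b : Fin m) → (G ⊗ Q) r (k ↑ʳ b) ≡ e r (k ↑ʳ b)
  GQ-right r b = trans (Σ-cong N (λ t → cong (G r t *_) (Q-right t b))) (GH≈I r (k ↑ʳ b))

-- Positive definite matrices

SymmetricMat : ∀ {n} → Mat n n → Set
SymmetricMat {n} M = ∀ i j → M i j ≡ M j i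

bil-e : ∀ n (M : Mat n n) i j → bil M (e i) (e j) ≡ M i j
bil-e n M i j = begin
  Σ[ n ] (λ i′ → Σ[ n ] (λ j′ → e i i′ * (M i′ j′ * e j j′)))
    ≡⟨ Σ-cong n (λ i′ → *-distribˡ-Σ n (e i i′) (λ j′ → M i′ j′ * e j j′)) ⟨
  Σ[ n ] (λ i′ → e i i′ * Σ[ n ] (λ j′ → M i′ j′ * e j j′))
    ≡⟨ Σ-e-* n i (λ i′ → Σ[ n ] (λ j′ → M i′ j′ * e j j′)) ⟩
  Σ[ n ] (λ j′ → M i j′ * e j j′)
    ≡⟨ Σ-cong n (λ j′ → cong (M i j′ *_) (e-comm j j′)) ⟩
  Σ[ n ] (λ j′ → M i j′ * e j′ j)
    ≡⟨ Σ-*-e n j (M i) ⟩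
  M i j ∎

schur : ∀ {n} → Mat (suc n) (suc n) → Mat n n
schur M p q = M (suc p) (suc q) + - (M (suc p) zero * (recip (M zero zero) * M zero (suc q)))

schur-symmetric : ∀ {n} (M : Mat (suc n) (suc n)) → SymmetricMat M → SymmetricMat (schur M)
schur-symmetric M M-sym p q = cong₂ (λ x y → x + - y) (M-sym (suc p) (suc q))
  (trans (cong₂ (λ x y → x * (recip (M zero zero) * y)) (M-sym (suc p) zero) (M-sym zero (suc q)))
    (solve 3 (λ x i y → x :* (i :* y) := y :* (i :* x)) refl (M zero (suc p)) (recip (M zero zero)) (M (suc q) zero)))

-- M = L ⊗ U with L unit lower triangular and U = (first row of M) over (0 | schur M).
det-schur : ∀ n (M : Mat (suc n) (suc n)) → M zero zero ≢ 0ℚ → det (suc n) M ≡ M zero zero * det n (schur M)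
det-schur n M a≢0 = begin
  det (suc n) M            ≡⟨ det-cong (suc n) M≈LU ⟩
  det (suc n) (L ⊗ U)      ≡⟨ det-⊗ (suc n) L U ⟩
  det (suc n) L * det (suc n) U
    ≡⟨ cong₂ _*_ detL detU ⟩
  1ℚ * (a * det n (schur M)) ≡⟨ ℚP.*-identityˡ _ ⟩
  a * det n (schur M)      ∎
  where
  a = M zero zero
  a⁻¹ = recip a
  L U : Mat (suc n) (suc n)
  L zero zero = 1ℚ
  L zero (suc q) = 0ℚ
  L (suc p) zero = M (suc p) zero * a⁻¹
  L (suc p) (suc q) = e p q
  U zero c = M zero c
  U (suc p) zero = 0ℚ
  U (suc p) (suc q) = schur M p q
  M≈LU : M ≈ᴹ (L ⊗ U)
  M≈LU zero c = sym (begin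
    1ℚ * M zero c + Σ[ n ] (λ p → 0ℚ * U (suc p) c)
      ≡⟨ cong₂ _+_ (ℚP.*-identityˡ (M zero c)) (Σ-zero n (λ p → ℚP.*-zeroˡ (U (suc p) c))) ⟩
    M zero c + 0ℚ ≡⟨ ℚP.+-identityʳ _ ⟩
    M zero c ∎)
  M≈LU (suc p) c = sym (begin
    (M (suc p) zero * a⁻¹) * M zero c + Σ[ n ] (λ q → e p q * U (suc q) c)
      ≡⟨ cong ((M (suc p) zero * a⁻¹) * M zero c +_) (Σ-e-* n p (λ q → U (suc q) c)) ⟩
    (M (suc p) zero * a⁻¹) * M zero c + U (suc p) c
      ≡⟨ row c ⟩
    M (suc p) c ∎)
    where
    row : ∀ c → (M (suc p) zero * a⁻¹) * M zero c + U (suc p) c ≡ M (suc p) c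
    row zero = begin
      (M (suc p) zero * a⁻¹) * a + 0ℚ
        ≡⟨ solve 3 (λ x i y → (x :* i) :* y :+ con 0ℚ := x :* (i :* y)) refl (M (suc p) zero) a⁻¹ a ⟩
      M (suc p) zero * (a⁻¹ * a)        ≡⟨ cong (M (suc p) zero *_) (recip-inverseˡ a a≢0) ⟩
      M (suc p) zero * 1ℚ               ≡⟨ ℚP.*-identityʳ _ ⟩
      M (suc p) zero                    ∎
    row (suc q) = solve 4 (λ x i y z → (x :* i) :* y :+ (z :+ :- (x :* (i :* y))) := z) refl
                    (M (suc p) zero) a⁻¹ (M zero (suc q)) (M (suc p) (suc q))
  detL : det (suc n) L ≡ 1ℚ
  detL = begin
    det (suc n) L
      ≡⟨ Σ-single (suc n) zero (detTerm n L)
           (λ { zero 0≢0 → ⊥-elim (0≢0 refl)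
              ; (suc q) _ → term≡0ˡ (sgn (toℕ (suc q))) 0ℚ (det n (minor L zero (suc q))) refl }) ⟩
    1ℚ * (1ℚ * det n (minor L zero zero))
      ≡⟨ cong (λ x → 1ℚ * (1ℚ * x)) (det-idMat n) ⟩
    1ℚ ∎
  detU : det (suc n) U ≡ a * det n (schur M)
  detU = begin
    det (suc n) U
      ≡⟨ Σ-single (suc n) zero (detTerm n U)
           (λ { zero 0≢0 → ⊥-elim (0≢0 refl)
              ; (suc q) _ → term≡0ʳ (sgn (toℕ (suc q))) (M zero (suc q)) (det n (minor U zero (suc q)))
                  (det-zeroColumn n (minor U zero (suc q)) (punchOut (sq≢0 q))
                    (λ r → cong (U (suc r)) (FinP.punchIn-punchOut (sq≢0 q)))) }) ⟩
    1ℚ * (a * det n (schur M)) ≡⟨ ℚP.*-identityˡ _ ⟩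
    a * det n (schur M) ∎
    where
    sq≢0 : ∀ q → suc q ≢ zero
    sq≢0 q ()

-- Completing the square: with a = M 0 0 and u = Σ_q M 0 (q+1) · x q, the form of M at (t ; x)
-- is a (t + u / a)² plus the form of schur M at x.
bil-schur : ∀ n (M : Mat (suc n) (suc n)) → SymmetricMat M → M zero zero ≢ 0ℚ → (x : Vecℚ n) →
  let t = - (recip (M zero zero) * Σ[ n ] (λ q → M zero (suc q) * x q))
  in bil M (t ∷ x) (t ∷ x) ≡ bil (schur M) x x
bil-schur n M M-sym a≢0 x = begin
  bil M y y
    ≡⟨ bil-expand ⟩
  (t * (a * t) + t * u) + (w * t + C)
    ≡⟨ cong (λ z → (t * (a * t) + t * u) + (z * t + C)) w≡u ⟩
  (t * (a * t) + t * u) + (u * t + C)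
    ≡⟨ solve 4 (λ a ia u C →
           ((:- (ia :* u)) :* (a :* (:- (ia :* u))) :+ (:- (ia :* u)) :* u) :+ (u :* (:- (ia :* u)) :+ C) :=
                  (C :+ :- (u :* (ia :* u))) :+ (ia :* u :* u) :* ((ia :* a) :+ :- con 1ℚ)) refl a a⁻¹ u C ⟩
  (C + - (u * (a⁻¹ * u))) + (a⁻¹ * u * u) * (a⁻¹ * a + - 1ℚ)
    ≡⟨ cong (λ z → (C + - (u * (a⁻¹ * u))) + (a⁻¹ * u * u) * (z + - 1ℚ)) (recip-inverseˡ a a≢0) ⟩
  (C + - (u * (a⁻¹ * u))) + (a⁻¹ * u * u) * (1ℚ + - 1ℚ)
    ≡⟨ solve 3 (λ C u v → (C :+ :- u) :+ v :* (con 1ℚ :+ :- con 1ℚ) := C :+ :- u) refl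
         C (u * (a⁻¹ * u)) (a⁻¹ * u * u) ⟩
  C + - (u * (a⁻¹ * u))
    ≡⟨ cong (λ z → C + - (z * (a⁻¹ * u))) w≡u ⟨
  C + - (w * (a⁻¹ * u))
    ≡⟨ bil-schur-expand ⟨
  bil (schur M) x x ∎
  where
  a = M zero zero
  a⁻¹ = recip a
  u = Σ[ n ] (λ q → M zero (suc q) * x q)
  w = Σ[ n ] (λ p → x p * M (suc p) zero)
  C = Σ[ n ] (λ p → Σ[ n ] (λ q → x p * (M (suc p) (suc q) * x q)))
  t = - (a⁻¹ * u)
  y = t ∷ x
  w≡u : w ≡ u
  w≡u = Σ-cong n (λ p → trans (ℚP.*-comm (x p) _) (cong (_* x p) (M-sym (suc p) zero)))
  bil-expand : bil M y y ≡ (t * (a * t) + t * u) + (w * t + C)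
  bil-expand = cong₂ _+_ (cong (t * (a * t) +_) (sym (*-distribˡ-Σ n t (λ q → M zero (suc q) * x q))))
    (trans (Σ-distrib-+ n (λ p → x p * (M (suc p) zero * t))
                          (λ p → Σ[ n ] (λ q → x p * (M (suc p) (suc q) * x q))))
           (cong (_+ C) (trans (Σ-cong n (λ p → sym (ℚP.*-assoc (x p) (M (suc p) zero) t)))
                               (sym (*-distribʳ-Σ n t (λ p → x p * M (suc p) zero))))))
  bil-schur-expand : bil (schur M) x x ≡ C + - (w * (a⁻¹ * u))
  bil-schur-expand = begin
    Σ[ n ] (λ p → Σ[ n ] (λ q → x p * (schur M p q * x q)))
      ≡⟨ Σ-cong n (λ p → Σ-cong n (λ q → solve 6 (λ xp m mp i m0 xq →
           xp :* ((m :+ :- (mp :* (i :* m0))) :* xq) := xp :* (m :* xq) :+ :- ((xp :* mp) :* (i :* (m0 :* xq)))) refl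
           (x p) (M (suc p) (suc q)) (M (suc p) zero) a⁻¹ (M zero (suc q)) (x q))) ⟩
    Σ[ n ] (λ p → Σ[ n ] (λ q → x p * (M (suc p) (suc q) * x q)
                                + - ((x p * M (suc p) zero) * (a⁻¹ * (M zero (suc q) * x q)))))
      ≡⟨ trans (Σ-cong n (λ p → Σ-distrib-+ n _ _)) (Σ-distrib-+ n _ _) ⟩
    C + Σ[ n ] (λ p → Σ[ n ] (λ q → - ((x p * M (suc p) zero) * (a⁻¹ * (M zero (suc q) * x q)))))
      ≡⟨ cong (C +_) (Σ-cong n (λ p → trans (sym (neg-distrib-Σ n _))
           (cong -_ (trans (sym (*-distribˡ-Σ n (x p * M (suc p) zero) _))
                           (cong ((x p * M (suc p) zero) *_) (sym (*-distribˡ-Σ n a⁻¹ _))))))) ⟩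
    C + Σ[ n ] (λ p → - ((x p * M (suc p) zero) * (a⁻¹ * u)))
      ≡⟨ cong (C +_) (trans (sym (neg-distrib-Σ n _))
           (cong -_ (sym (*-distribʳ-Σ n (a⁻¹ * u) (λ p → x p * M (suc p) zero))))) ⟩
    C + - (w * (a⁻¹ * u)) ∎

schur-positiveDefinite : ∀ n (M : Mat (suc n) (suc n)) → SymmetricMat M → M zero zero ≢ 0ℚ →
  PositiveDefinite M → PositiveDefinite (schur M)
schur-positiveDefinite n M M-sym a≢0 M-pd x x≢0 =
  subst (0ℚ <_) (bil-schur n M M-sym a≢0 x) (M-pd (t ∷ x) (λ y≡0 → x≢0 (y≡0 ∘ suc)))
  where
  t = - (recip (M zero zero) * Σ[ n ] (λ q → M zero (suc q) * x q))

positiveDefinite⇒det>0 : ∀ n (M : Mat n n) → SymmetricMat M → PositiveDefinite M → 0ℚ < det n M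
positiveDefinite⇒det>0 zero M M-sym M-pd = ℚP.positive⁻¹ 1ℚ
positiveDefinite⇒det>0 (suc n) M M-sym M-pd =
  subst (0ℚ <_) (sym (det-schur n M a≢0))
    (ℚP.positive⁻¹ (a * det n (schur M)) {{ℚP.pos*pos⇒pos a {{positive a>0}} _ {{positive detS>0}}}})
  where
  a = M zero zero
  a>0 : 0ℚ < a
  a>0 = subst (0ℚ <_) (bil-e (suc n) M zero zero)
    (M-pd (e zero) (λ e₀≡0 → ℚP.1≢0 (trans (sym (e-diag {suc n} zero)) (e₀≡0 zero))))
  a≢0 : a ≢ 0ℚ
  a≢0 a≡0 = ℚP.<-irrefl (sym a≡0) a>0
  detS>0 : 0ℚ < det n (schur M)
  detS>0 = positiveDefinite⇒det>0 n (schur M) (schur-symmetric M M-sym) (schur-positiveDefinite n M M-sym a≢0 M-pd)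

fromℤ : ℤ → ℚ
fromℤ z = Data.Rational._/_ z 1

toℚᵘ-fromℤ : ∀ z → toℚᵘ (fromℤ z) ℚᵘ.≃ ℚᵘ.mkℚᵘ z 0
toℚᵘ-fromℤ z = ℚP.toℚᵘ-fromℚᵘ (ℚᵘ.mkℚᵘ z 0)

fromℤ-+ : ∀ a b → fromℤ (a ℤ.+ b) ≡ fromℤ a + fromℤ b
fromℤ-+ a b = ℚP.toℚᵘ-injective (ℚᵘP.≃-trans (toℚᵘ-fromℤ (a ℤ.+ b)) (ℚᵘP.≃-trans (ℚᵘ.*≡* sum≡)
  (ℚᵘP.≃-sym (ℚᵘP.≃-trans (ℚP.toℚᵘ-homo-+ (fromℤ a) (fromℤ b))
                          (ℚᵘP.+-cong (toℚᵘ-fromℤ a) (toℚᵘ-fromℤ b))))))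
  where
  sum≡ : (a ℤ.+ b) ℤ.* 1ℤ ≡ (a ℤ.* 1ℤ ℤ.+ b ℤ.* 1ℤ) ℤ.* 1ℤ
  sum≡ = trans (ℤP.*-identityʳ (a ℤ.+ b))
    (sym (trans (ℤP.*-identityʳ _) (cong₂ ℤ._+_ (ℤP.*-identityʳ a) (ℤP.*-identityʳ b))))

fromℤ-* : ∀ a b → fromℤ (a ℤ.* b) ≡ fromℤ a * fromℤ b
fromℤ-* a b = ℚP.toℚᵘ-injective (ℚᵘP.≃-trans (toℚᵘ-fromℤ (a ℤ.* b)) (ℚᵘP.≃-trans (ℚᵘ.*≡* refl)
  (ℚᵘP.≃-sym (ℚᵘP.≃-trans (ℚP.toℚᵘ-homo-* (fromℤ a) (fromℤ b))
                          (ℚᵘP.*-cong (toℚᵘ-fromℤ a) (toℚᵘ-fromℤ b))))))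

fromℤ-neg : ∀ a → fromℤ (ℤ.- a) ≡ - fromℤ a
fromℤ-neg a = ℚP.toℚᵘ-injective (ℚᵘP.≃-trans (toℚᵘ-fromℤ (ℤ.- a))
  (ℚᵘP.≃-sym (ℚᵘP.≃-trans (ℚP.toℚᵘ-homo‿- (fromℤ a)) (ℚᵘP.-‿cong (toℚᵘ-fromℤ a)))))

fromℤ-injective : ∀ a b → fromℤ a ≡ fromℤ b → a ≡ b
fromℤ-injective a b eq
  with ℚᵘP.≃-trans (ℚᵘP.≃-sym (toℚᵘ-fromℤ a)) (ℚᵘP.≃-trans (ℚP.toℚᵘ-cong eq) (toℚᵘ-fromℤ b))
... | ℚᵘ.*≡* a*1≡b*1 = trans (sym (ℤP.*-identityʳ a)) (trans a*1≡b*1 (ℤP.*-identityʳ b))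

IsInteger : ℚ → Set
IsInteger q = ∃ λ (z : ℤ) → q ≡ fromℤ z

integer-+ : ∀ {p q} → IsInteger p → IsInteger q → IsInteger (p + q)
integer-+ (a , refl) (b , refl) = a ℤ.+ b , sym (fromℤ-+ a b)

integer-* : ∀ {p q} → IsInteger p → IsInteger q → IsInteger (p * q)
integer-* (a , refl) (b , refl) = a ℤ.* b , sym (fromℤ-* a b)

integer-neg : ∀ {p} → IsInteger p → IsInteger (- p)
integer-neg (a , refl) = ℤ.- a , sym (fromℤ-neg a)

integer-1 : IsInteger 1ℚ
integer-1 = 1ℤ , refl

integer-Σ : ∀ n (f : Fin n → ℚ) → (∀ i → IsInteger (f i)) → IsInteger (Σ[ n ] f)
integer-Σ zero f f-int = 0ℤ , refl
integer-Σ (suc n) f f-int = integer-+ (f-int zero) (integer-Σ n (f ∘ suc) (f-int ∘ suc))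

integer-sgn : ∀ k → IsInteger (sgn k)
integer-sgn zero = integer-1
integer-sgn (suc k) = integer-neg (integer-sgn k)

integer-det : ∀ n (A : Mat n n) → (∀ i j → IsInteger (A i j)) → IsInteger (det n A)
integer-det zero A A-int = integer-1
integer-det (suc n) A A-int = integer-Σ (suc n) (detTerm n A) λ j →
  integer-* (integer-sgn (toℕ j)) (integer-* (A-int zero j) (integer-det n (minor A zero j) (λ a b → A-int _ _)))

IsIntegerMat : ∀ {m n} → Mat m n → Set
IsIntegerMat A = ∀ i j → IsInteger (A i j)

integer-⊗ : ∀ {m n p} {A : Mat m n} {B : Mat n p} →
  IsIntegerMat A → IsIntegerMat B → IsIntegerMat (A ⊗ B)
integer-⊗ {n = n} A-int B-int i j = integer-Σ n _ (λ l → integer-* (A-int i l) (B-int l j))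

integer-scaledInv : ∀ n (A : Mat n n) (κ : ℚ) → IsIntegerMat A →
  IsInteger (κ * recip (det n A)) → IsIntegerMat (λ i j → κ * inv n A i j)
integer-scaledInv (suc n) A κ A-int κ/det-int i j =
  subst IsInteger (ℚP.*-assoc κ (recip (det (suc n) A)) (sgn (toℕ i ℕ.+ toℕ j) * det n (minor A j i)))
    (integer-* κ/det-int (integer-* (integer-sgn (toℕ i ℕ.+ toℕ j))
      (integer-det n (minor A j i) (λ a b → A-int (punchIn j a) (punchIn i b)))))

IsSign : ℚ → Set
IsSign x = x ≡ 1ℚ ⊎ x ≡ - 1ℚ

sign-* : ∀ {x y} → IsSign x → IsSign y → IsSign (x * y)
sign-* (inj₁ refl) (inj₁ refl) = inj₁ refl
sign-* (inj₁ refl) (inj₂ refl) = inj₂ refl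
sign-* (inj₂ refl) (inj₁ refl) = inj₂ refl
sign-* (inj₂ refl) (inj₂ refl) = inj₁ refl

sign-involutive : ∀ {x} → IsSign x → x * x ≡ 1ℚ
sign-involutive (inj₁ refl) = refl
sign-involutive (inj₂ refl) = refl

sign≢0 : ∀ {x} → IsSign x → x ≢ 0ℚ
sign≢0 (inj₁ refl) = λ ()
sign≢0 (inj₂ refl) = λ ()

sign-integer : ∀ {x} → IsSign x → IsInteger x
sign-integer (inj₁ refl) = integer-1
sign-integer (inj₂ refl) = integer-neg integer-1

sign-recip-integer : ∀ {x} → IsSign x → IsInteger (recip x)
sign-recip-integer (inj₁ refl) = integer-1
sign-recip-integer (inj₂ refl) = integer-neg integer-1

ℤ-unit : ∀ a b → a ℤ.* b ≡ 1ℤ → a ≡ 1ℤ ⊎ a ≡ -1ℤ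
ℤ-unit a b ab≡1
  with ℕP.m*n≡1⇒m≡1 ℤ.∣ a ∣ ℤ.∣ b ∣ (trans (sym (ℤP.abs-* a b)) (cong ℤ.∣_∣ ab≡1))
ℤ-unit ℤ.+[1+ .0 ] b ab≡1 | refl = inj₁ refl
ℤ-unit ℤ.-[1+ .0 ] b ab≡1 | refl = inj₂ refl

integerUnit⇒sign : ∀ x y → IsInteger x → IsInteger y → x * y ≡ 1ℚ → IsSign x
integerUnit⇒sign x y (a , refl) (b , refl) xy≡1 with ℤ-unit a b (fromℤ-injective _ _ (trans (fromℤ-* a b) xy≡1))
... | inj₁ refl = inj₁ refl
... | inj₂ refl = inj₂ refl

infixr 7 _·ᴹ_
_·ᴹ_ : ∀ {m n} → ℚ → Mat m n → Mat m n
(κ ·ᴹ A) i j = κ * A i j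

·ᴹ-⊗ˡ : ∀ {m n p} κ (A : Mat m n) (B : Mat n p) →
  κ ·ᴹ (A ⊗ B) ≈ᴹ (κ ·ᴹ A) ⊗ B
·ᴹ-⊗ˡ {n = n} κ A B i j = trans (*-distribˡ-Σ n κ (λ l → A i l * B l j))
  (Σ-cong n (λ l → sym (ℚP.*-assoc κ (A i l) (B l j))))

·ᴹ-⊗ʳ : ∀ {m n p} κ (A : Mat m n) (B : Mat n p) →
  κ ·ᴹ (A ⊗ B) ≈ᴹ A ⊗ (κ ·ᴹ B)
·ᴹ-⊗ʳ {n = n} κ A B i j = trans (*-distribˡ-Σ n κ (λ l → A i l * B l j))
  (Σ-cong n (λ l → solve 3 (λ k a b → k :* (a :* b) := a :* (k :* b)) refl κ (A i l) (B l j)))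

det-·ᴹ : ∀ n κ (A : Mat n n) → det n (κ ·ᴹ A) ≡ κ ^ n * det n A
det-·ᴹ zero κ A = sym (ℚP.*-identityˡ 1ℚ)
det-·ᴹ (suc n) κ A = begin
  Σ[ suc n ] (detTerm n (κ ·ᴹ A))
    ≡⟨ Σ-cong (suc n) (λ j → cong (λ z → sgn (toℕ j) * ((κ * A zero j) * z))
                                   (det-·ᴹ n κ (minor A zero j))) ⟩
  Σ[ suc n ] (λ j → sgn (toℕ j) * ((κ * A zero j) * (κ ^ n * det n (minor A zero j))))
    ≡⟨ Σ-cong (suc n) (λ j →
         solve 5 (λ s k a p d → s :* ((k :* a) :* (p :* d)) := (k :* p) :* (s :* (a :* d))) refl
         (sgn (toℕ j)) κ (A zero j) (κ ^ n) (det n (minor A zero j))) ⟩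
  Σ[ suc n ] (λ j → κ ^ suc n * detTerm n A j)
    ≡⟨ *-distribˡ-Σ (suc n) (κ ^ suc n) (detTerm n A) ⟨
  κ ^ suc n * det (suc n) A ∎

*-≢0 : ∀ {a b} → a ≢ 0ℚ → b ≢ 0ℚ → a * b ≢ 0ℚ
*-≢0 {a} {b} a≢0 b≢0 ab≡0 = b≢0 (begin
  b                    ≡⟨ ℚP.*-identityˡ b ⟨
  1ℚ * b               ≡⟨ cong (_* b) (recip-inverseˡ a a≢0) ⟨
  (recip a * a) * b    ≡⟨ ℚP.*-assoc (recip a) a b ⟩
  recip a * (a * b)    ≡⟨ cong (recip a *_) ab≡0 ⟩
  recip a * 0ℚ         ≡⟨ ℚP.*-zeroʳ (recip a) ⟩
  0ℚ                   ∎)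

^-≢0 : ∀ {x} n → x ≢ 0ℚ → x ^ n ≢ 0ℚ
^-≢0 zero x≢0 = ℚP.1≢0
^-≢0 (suc n) x≢0 = *-≢0 x≢0 (^-≢0 n x≢0)

recip-≢0 : ∀ {d} → d ≢ 0ℚ → recip d ≢ 0ℚ
recip-≢0 {d} d≢0 d⁻¹≡0 =
  ℚP.1≢0 (trans (sym (recip-inverseˡ d d≢0)) (trans (cong (_* d) d⁻¹≡0) (ℚP.*-zeroˡ d)))

-- The Gram matrices of q_L and of q_{L⊥}

bil-columns : ∀ {n} (M A B : Mat n n) (x y : Vecℚ n) I J → (∀ r → x r ≡ A r I) → (∀ r → y r ≡ B r J) →
  bil M x y ≡ (transpose A ⊗ (M ⊗ B)) I J
bil-columns {n} M A B x y I J x≡ y≡ = Σ-cong n λ r → trans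
  (Σ-cong n (λ s → cong₂ (λ u v → u * (M r s * v)) (x≡ r) (y≡ s)))
  (sym (*-distribˡ-Σ n (A r I) (λ s → M r s * B s J)))

-- The vectors (u ; 0) and (0 ; u), as in the private incL and incR of Defs.
embedˡ : ∀ k m → Vecℚ k → Vecℚ (k ℕ.+ m)
embedˡ k m u j = Data.Sum.[ u , (λ _ → 0ℚ) ]′ (splitAt k j)

embedʳ : ∀ k m → Vecℚ m → Vecℚ (k ℕ.+ m)
embedʳ k m u j = Data.Sum.[ (λ _ → 0ℚ) , u ]′ (splitAt k j)

embedˡ-e : ∀ k m (i : Fin k) c → embedˡ k m (e i) c ≡ e (i ↑ˡ m) c
embedˡ-e k m i c with ↑-cases k m c
... | inj₁ (a , refl) rewrite FinP.splitAt-↑ˡ k a m = sym (e-reindex (_↑ˡ m) (FinP.↑ˡ-injective m _ _) i a)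
... | inj₂ (b , refl) rewrite FinP.splitAt-↑ʳ k m b = sym (e-offDiag (↑ˡ≢↑ʳ i b))

embedʳ-e : ∀ k m (i : Fin m) c → embedʳ k m (e i) c ≡ e (k ↑ʳ i) c
embedʳ-e k m i c with ↑-cases k m c
... | inj₁ (a , refl) rewrite FinP.splitAt-↑ˡ k a m = sym (e-offDiag (↑ˡ≢↑ʳ a i ∘ sym))
... | inj₂ (b , refl) rewrite FinP.splitAt-↑ʳ k m b = sym (e-reindex (k ↑ʳ_) (FinP.↑ʳ-injective k _ _) i b)

module GramMatrices (k m : ℕ) (MQ g : ZMat (k ℕ.+ m) (k ℕ.+ m)) where

  N = k ℕ.+ m
  Mq = toℚMat MQ
  gq = toℚMat g
  M⁻¹ = inv N Mq
  g⁻¹ = inv N gq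

  G H : Mat N N
  G = transpose gq ⊗ (Mq ⊗ gq)
  H = g⁻¹ ⊗ (transpose M⁻¹ ⊗ transpose g⁻¹)

  gramL≈upperLeft : gramL k m MQ g ≈ᴹ upperLeft k m G
  gramL≈upperLeft i j = bil-columns Mq gq gq _ _ (i ↑ˡ m) (j ↑ˡ m) (column i) (column j)
    where
    column : ∀ i r → (gq · embedˡ k m (e i)) r ≡ gq r (i ↑ˡ m)
    column i r = trans (Σ-cong N (λ c → cong (gq r c *_) (trans (embedˡ-e k m i c) (e-comm (i ↑ˡ m) c))))
                       (Σ-*-e N (i ↑ˡ m) (gq r))

  gramPerp₀≈lowerRight : (M⁻¹ ⊗ Mq) ≈ᴹ idMat N → gramPerp₀ k m MQ g ≈ᴹ lowerRight k m H
  gramPerp₀≈lowerRight M⁻¹M≈I i j = trans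
    (bil-columns Mq (transpose W) (transpose W) _ _ (k ↑ʳ i) (k ↑ʳ j) (column i) (column j))
    (WMWᵀ≈H (k ↑ʳ i) (k ↑ʳ j))
    where
    W = g⁻¹ ⊗ M⁻¹
    g⁻ᵀe : ∀ i c → (invT N gq · embedʳ k m (e i)) c ≡ g⁻¹ (k ↑ʳ i) c
    g⁻ᵀe i c = trans
      (Σ-cong N (λ c′ → cong (g⁻¹ c′ c *_) (trans (embedʳ-e k m i c′) (e-comm (k ↑ʳ i) c′))))
                     (Σ-*-e N (k ↑ʳ i) (λ c′ → g⁻¹ c′ c))
    column : ∀ i r → (invT N Mq · (invT N gq · embedʳ k m (e i))) r ≡ W (k ↑ʳ i) r
    column i r = Σ-cong N λ c →
      trans (cong (M⁻¹ c r *_) (g⁻ᵀe i c)) (ℚP.*-comm (M⁻¹ c r) (g⁻¹ (k ↑ʳ i) c))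
    X = transpose M⁻¹ ⊗ transpose g⁻¹
    WMWᵀ≈H : W ⊗ (Mq ⊗ transpose W) ≈ᴹ H
    WMWᵀ≈H = beginᴹ
      W ⊗ (Mq ⊗ transpose W)     ≈⟨ ⊗-congˡ W (⊗-congˡ Mq (transpose-⊗ g⁻¹ M⁻¹)) ⟩
      (g⁻¹ ⊗ M⁻¹) ⊗ (Mq ⊗ X)     ≈⟨ ⊗-assoc g⁻¹ M⁻¹ (Mq ⊗ X) ⟩
      g⁻¹ ⊗ (M⁻¹ ⊗ (Mq ⊗ X))     ≈⟨ ⊗-congˡ g⁻¹ M⁻¹MX≈X ⟩
      H                          ∎ᴹ
      where
      open ≈ᴹ-Reasoning N N
      M⁻¹MX≈X : M⁻¹ ⊗ (Mq ⊗ X) ≈ᴹ X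
      M⁻¹MX≈X = beginᴹ
        M⁻¹ ⊗ (Mq ⊗ X)     ≈⟨ ⊗-assoc M⁻¹ Mq X ⟨
        (M⁻¹ ⊗ Mq) ⊗ X     ≈⟨ ⊗-congʳ M⁻¹M≈I ⟩
        idMat N ⊗ X        ≈⟨ ⊗-identityˡ N X ⟩
        X                  ∎ᴹ

  G⊗H≈I : SymmetricMat Mq → (M⁻¹ ⊗ Mq) ≈ᴹ idMat N →
    (gq ⊗ g⁻¹) ≈ᴹ idMat N → (g⁻¹ ⊗ gq) ≈ᴹ idMat N → (G ⊗ H) ≈ᴹ idMat N
  G⊗H≈I Mq-sym M⁻¹M≈I gg⁻¹≈I g⁻¹g≈I = beginᴹ
    G ⊗ H                               ≈⟨ ⊗-assoc (transpose gq) (Mq ⊗ gq) H ⟩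
    transpose gq ⊗ ((Mq ⊗ gq) ⊗ H)      ≈⟨ ⊗-congˡ (transpose gq) MgH≈g⁻ᵀ ⟩
    transpose gq ⊗ transpose g⁻¹        ≈⟨ transpose-inverse N gq g⁻¹ g⁻¹g≈I ⟩
    idMat N                             ∎ᴹ
    where
    open ≈ᴹ-Reasoning N N
    X = transpose M⁻¹ ⊗ transpose g⁻¹
    MM⁻ᵀ≈I : (Mq ⊗ transpose M⁻¹) ≈ᴹ idMat N
    MM⁻ᵀ≈I i j =
      trans (Σ-cong N (λ l → cong (_* M⁻¹ j l) (Mq-sym i l))) (transpose-inverse N Mq M⁻¹ M⁻¹M≈I i j)
    MgH≈g⁻ᵀ : (Mq ⊗ gq) ⊗ H ≈ᴹ transpose g⁻¹
    MgH≈g⁻ᵀ = beginᴹ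
      (Mq ⊗ gq) ⊗ (g⁻¹ ⊗ X)           ≈⟨ ⊗-assoc Mq gq (g⁻¹ ⊗ X) ⟩
      Mq ⊗ (gq ⊗ (g⁻¹ ⊗ X))           ≈⟨ ⊗-congˡ Mq (⊗-assoc gq g⁻¹ X) ⟨
      Mq ⊗ ((gq ⊗ g⁻¹) ⊗ X)           ≈⟨ ⊗-congˡ Mq (⊗-congʳ gg⁻¹≈I) ⟩
      Mq ⊗ (idMat N ⊗ X)              ≈⟨ ⊗-congˡ Mq (⊗-identityˡ N X) ⟩
      Mq ⊗ X                          ≈⟨ ⊗-assoc Mq (transpose M⁻¹) (transpose g⁻¹) ⟨
      (Mq ⊗ transpose M⁻¹) ⊗ transpose g⁻¹
                                      ≈⟨ ⊗-congʳ MM⁻ᵀ≈I ⟩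
      idMat N ⊗ transpose g⁻¹         ≈⟨ ⊗-identityˡ N (transpose g⁻¹) ⟩
      transpose g⁻¹                   ∎ᴹ

module OrthogonalComplement (k m : ℕ) (MQ : ZMat (k ℕ.+ m) (k ℕ.+ m))
  (MQ-sym : SymmetricZ MQ) (MQ-pd : PositiveDefinite (toℚMat MQ)) where

  N = k ℕ.+ m
  Mq = toℚMat MQ
  dM = det N Mq

  Mq-sym : SymmetricMat Mq
  Mq-sym i j = cong fromℤ (MQ-sym i j)

  dM≢0 : dM ≢ 0ℚ
  dM≢0 dM≡0 = ℚP.<-irrefl (sym dM≡0) (positiveDefinite⇒det>0 N Mq Mq-sym MQ-pd)

  M⁻¹M≈I : (inv N Mq ⊗ Mq) ≈ᴹ idMat N
  M⁻¹M≈I = inverseʳ⇒inverseˡ N Mq (inv N Mq) (inv-inverseʳ N Mq dM≢0)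

  Mq-integer : IsIntegerMat Mq
  Mq-integer i j = MQ i j , refl

  D : ℤ
  D = proj₁ (integer-det N Mq Mq-integer)

  K : ℕ
  K = ℤ.∣ D ∣

  K/dM-sign : IsSign (fromℤ (ℤ.+ K) * recip dM)
  K/dM-sign = signOf (proj₂ (integer-det N Mq Mq-integer))
    where
    K≡±dM : ∀ z → dM ≡ fromℤ z → fromℤ (ℤ.+ ℤ.∣ z ∣) ≡ dM ⊎ fromℤ (ℤ.+ ℤ.∣ z ∣) ≡ - dM
    K≡±dM (ℤ.+ n) dM≡z = inj₁ (sym dM≡z)
    K≡±dM ℤ.-[1+ n ] dM≡z = inj₂ (trans (fromℤ-neg ℤ.-[1+ n ]) (cong -_ (sym dM≡z)))
    dM/dM≡1 : dM * recip dM ≡ 1ℚ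
    dM/dM≡1 = trans (ℚP.*-comm dM (recip dM)) (recip-inverseˡ dM dM≢0)
    signOf : dM ≡ fromℤ D → IsSign (fromℤ (ℤ.+ K) * recip dM)
    signOf dM≡D with K≡±dM D dM≡D
    ... | inj₁ K≡dM = inj₁ (trans (cong (_* recip dM) K≡dM) dM/dM≡1)
    ... | inj₂ K≡-dM = inj₂ (trans (cong (_* recip dM) K≡-dM)
                         (trans (sym (ℚP.neg-distribˡ-* dM (recip dM))) (cong -_ dM/dM≡1)))

  1≤K : 1 ≤ K
  1≤K = nonzero {D} (proj₂ (integer-det N Mq Mq-integer))
    where
    nonzero : ∀ {z} → dM ≡ fromℤ z → 1 ≤ ℤ.∣ z ∣
    nonzero {ℤ.+ zero} dM≡0 = ⊥-elim (dM≢0 dM≡0)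
    nonzero {ℤ.+[1+ n ]} _ = s≤s z≤n
    nonzero {ℤ.-[1+ n ]} _ = s≤s z≤n

  module WithBasis (g : ZMat N N) (g-unimodular : Unimodular g) where

    open GramMatrices k m MQ g hiding (N; Mq)

    dg = det N gq
    dgᵀ = det N (transpose gq)

    g⁻¹g≈I : (g⁻¹ ⊗ gq) ≈ᴹ idMat N
    g⁻¹g≈I = inverseʳ⇒inverseˡ N gq g⁻¹ (inv-inverseʳ N gq (sign≢0 g-unimodular))

    g⁻¹-integer : IsIntegerMat g⁻¹
    g⁻¹-integer i j = subst IsInteger (ℚP.*-identityˡ (g⁻¹ i j))
      (integer-scaledInv N gq 1ℚ (λ i j → g i j , refl)
        (subst IsInteger (sym (ℚP.*-identityˡ _)) (sign-recip-integer g-unimodular)) i j)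

    -- det gᵀ is an integer with integral inverse det g⁻ᵀ, hence ±1.
    dgᵀ-sign : IsSign dgᵀ
    dgᵀ-sign = integerUnit⇒sign dgᵀ (det N (transpose g⁻¹))
      (integer-det N (transpose gq) (λ i j → g j i , refl))
      (integer-det N (transpose g⁻¹) (λ i j → g⁻¹-integer j i))
      (trans (sym (det-⊗ N (transpose gq) (transpose g⁻¹)))
             (trans (det-cong N (transpose-inverse N gq g⁻¹ g⁻¹g≈I)) (det-idMat N)))

    σ : ℚ
    σ = dgᵀ * dg

    σ-sign : IsSign σ
    σ-sign = sign-* dgᵀ-sign g-unimodular

    det-gramPerp₀ : det m (gramPerp₀ k m MQ g) ≡ (σ * recip dM) * det k (gramL k m MQ g)
    det-gramPerp₀ = sym (begin
      (σ * recip dM) * det k (gramL k m MQ g)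
        ≡⟨ cong ((σ * recip dM) *_) (det-cong k gramL≈upperLeft) ⟩
      (σ * recip dM) * det k (upperLeft k m G)
        ≡⟨ cong ((σ * recip dM) *_) (jacobi-complementaryMinor k m G H GH≈I) ⟨
      (σ * recip dM) * (det N G * det m (lowerRight k m H))
        ≡⟨ cong (λ z → (σ * recip dM) * (z * det m (lowerRight k m H)))
             (trans (det-⊗ N (transpose gq) (Mq ⊗ gq)) (cong (dgᵀ *_) (det-⊗ N Mq gq))) ⟩
      (dgᵀ * dg * recip dM) * ((dgᵀ * (dM * dg)) * det m (lowerRight k m H))
        ≡⟨ solve 5 (λ t d r x p →
               (t :* d :* r) :* ((t :* (x :* d)) :* p) := ((t :* t) :* (d :* d)) :* ((r :* x) :* p)) refl
             dgᵀ dg (recip dM) dM (det m (lowerRight k m H)) ⟩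
      ((dgᵀ * dgᵀ) * (dg * dg)) * ((recip dM * dM) * det m (lowerRight k m H))
        ≡⟨ cong₂ (λ x y → x * (y * det m (lowerRight k m H)))
             (cong₂ _*_ (sign-involutive dgᵀ-sign) (sign-involutive g-unimodular)) (recip-inverseˡ dM dM≢0) ⟩
      (1ℚ * 1ℚ) * (1ℚ * det m (lowerRight k m H))
        ≡⟨ solve 1 (λ x → (con 1ℚ :* con 1ℚ) :* (con 1ℚ :* x) := x) refl (det m (lowerRight k m H)) ⟩
      det m (lowerRight k m H)
        ≡⟨ det-cong m (gramPerp₀≈lowerRight M⁻¹M≈I) ⟨
      det m (gramPerp₀ k m MQ g) ∎)
      where
      GH≈I : (G ⊗ H) ≈ᴹ idMat N
      GH≈I = G⊗H≈I Mq-sym M⁻¹M≈I (inv-inverseʳ N gq (sign≢0 g-unimodular)) g⁻¹g≈I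

    -- |det M_Q| · M_Q⁻¹ is integral (adjugate formula) and so is g⁻¹.
    gramPerp₀-integralScale : IsIntegral (scale K (gramPerp₀ k m MQ g))
    gramPerp₀-integralScale a b = subst IsInteger (sym scaled≡)
      (integer-⊗ g⁻¹-integer (integer-⊗ (λ i j → KM⁻¹-integer j i) (λ i j → g⁻¹-integer j i))
        (k ↑ʳ a) (k ↑ʳ b))
      where
      κ = fromℤ (ℤ.+ K)
      KM⁻¹-integer : IsIntegerMat (κ ·ᴹ M⁻¹)
      KM⁻¹-integer = integer-scaledInv N Mq κ Mq-integer (sign-integer K/dM-sign)
      scaled≡ : scale K (gramPerp₀ k m MQ g) a b
              ≡ (g⁻¹ ⊗ ((κ ·ᴹ transpose M⁻¹) ⊗ transpose g⁻¹)) (k ↑ʳ a) (k ↑ʳ b)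
      scaled≡ = begin
        κ * gramPerp₀ k m MQ g a b
          ≡⟨ cong (κ *_) (gramPerp₀≈lowerRight M⁻¹M≈I a b) ⟩
        κ * H (k ↑ʳ a) (k ↑ʳ b)
          ≡⟨ ·ᴹ-⊗ʳ κ g⁻¹ (transpose M⁻¹ ⊗ transpose g⁻¹) (k ↑ʳ a) (k ↑ʳ b) ⟩
        (g⁻¹ ⊗ (κ ·ᴹ (transpose M⁻¹ ⊗ transpose g⁻¹))) (k ↑ʳ a) (k ↑ʳ b)
          ≡⟨ ⊗-congˡ g⁻¹ (·ᴹ-⊗ˡ κ (transpose M⁻¹) (transpose g⁻¹)) (k ↑ʳ a) (k ↑ʳ b) ⟩
        (g⁻¹ ⊗ ((κ ·ᴹ transpose M⁻¹) ⊗ transpose g⁻¹)) (k ↑ʳ a) (k ↑ʳ b) ∎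

  factor : ℚ → ℕ → ℚ
  factor σ c = fromℤ (ℤ.+ c) ^ m * (σ * recip dM)

  factors : List ℚ
  factors = map (factor 1ℚ ∘ suc) (upTo K) ++ map (factor (- 1ℚ) ∘ suc) (upTo K)

  factors≢0 : All (_≢ 0ℚ) factors
  factors≢0 = AllP.++⁺ (AllP.map⁺ (All.universal (factor≢0 (inj₁ refl)) (upTo K)))
                       (AllP.map⁺ (All.universal (factor≢0 (inj₂ refl)) (upTo K)))
    where
    factor≢0 : ∀ {σ} → IsSign σ → ∀ c → factor σ (suc c) ≢ 0ℚ
    factor≢0 σ-sign c = *-≢0 (^-≢0 m (λ c+1≡0 → case (fromℤ-injective (ℤ.+ suc c) 0ℤ c+1≡0)))
                            (*-≢0 (sign≢0 σ-sign) (recip-≢0 dM≢0))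
      where
      case : ℤ.+ suc c ≢ 0ℤ
      case ()

  factor∈factors : ∀ {σ} → IsSign σ → ∀ c → suc c ≤ K → factor σ (suc c) ∈ factors
  factor∈factors (inj₁ refl) c c<K = ∈P.∈-++⁺ˡ (∈P.∈-map⁺ (factor 1ℚ ∘ suc) (∈P.∈-upTo⁺ c<K))
  factor∈factors (inj₂ refl) c c<K =
    ∈P.∈-++⁺ʳ _ (∈P.∈-map⁺ (factor (- 1ℚ) ∘ suc) (∈P.∈-upTo⁺ c<K))

mainTheorem6 :
    (k m : ℕ) → 1 ≤ k → 1 ≤ m →
    (MQ : ZMat (k Data.Nat.+ m) (k Data.Nat.+ m)) →
    SymmetricZ MQ → PositiveDefinite (toℚMat MQ) →
    Σ (List ℚ) λ F → All (λ a → a ≢ 0ℚ) F ×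
      ((g : ZMat (k Data.Nat.+ m) (k Data.Nat.+ m)) → Unimodular g →
        (c : ℕ) → IsSmallestIntegralScale c (gramPerp₀ k m MQ g) →
        ∃ λ a → a ∈ F × det m (scale c (gramPerp₀ k m MQ g)) ≡ a * det k (gramL k m MQ g))
mainTheorem6 k m _ _ MQ MQ-sym MQ-pd = factors , factors≢0 , complement
  where
  open OrthogonalComplement k m MQ MQ-sym MQ-pd
  complement : (g : ZMat N N) → Unimodular g → (c : ℕ) → IsSmallestIntegralScale c (gramPerp₀ k m MQ g) →
    ∃ λ a → a ∈ factors × det m (scale c (gramPerp₀ k m MQ g)) ≡ a * det k (gramL k m MQ g)
  complement g g-unimodular zero (() , _)
  complement g g-unimodular (suc c) (_ , _ , smallest) =
    factor σ (suc c) , factor∈factors σ-sign c (smallest K 1≤K gramPerp₀-integralScale) , (begin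
      det m (scale (suc c) (gramPerp₀ k m MQ g))
        ≡⟨ det-·ᴹ m (fromℤ (ℤ.+ suc c)) (gramPerp₀ k m MQ g) ⟩
      fromℤ (ℤ.+ suc c) ^ m * det m (gramPerp₀ k m MQ g)
        ≡⟨ cong (fromℤ (ℤ.+ suc c) ^ m *_) det-gramPerp₀ ⟩
      fromℤ (ℤ.+ suc c) ^ m * ((σ * recip dM) * det k (gramL k m MQ g))
        ≡⟨ ℚP.*-assoc (fromℤ (ℤ.+ suc c) ^ m) (σ * recip dM) (det k (gramL k m MQ g)) ⟨
      factor σ (suc c) * det k (gramL k m MQ g) ∎)
    where
    open WithBasis g g-unimodular
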